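{- Let $p$ be the mesh pattern $(132,\;R)$ with shaded boxes $R=\{(0,2),(0,3),(1,2),(1,3),(2,0),(2,1),(2,2),(2,3),(3,1),(3,2)\}$, and for $n\ge0$ let $S_n(p)$ be the set of permutations of $[n]$ that contain no occurrence of $p$. Then, as formal power series, \[\sum_{n\geq 0}|S_n(p)|\,x^n=\sum_{k\geq 0}k!\left(\frac{x}{1+x^2}\right)^{k}.\]
   Context: Mesh patterns: a mesh pattern is a pair $(\tau,R)$ where $\tau$ is a permutation of $[k]$ and $R\subseteq\{0,\dots,k\}\times\{0,\dots,k\}$ is a set of shaded boxes; box $(a,b)$ is the unit square $[a,a+1]\times[b,b+1]$ in the plot of the points $(i,\tau(i))$. An occurrence of $(\tau,R)$ in a permutation $\sigma$ of $[n]$ is a sequence of indices $i_1<\dots<i_k$ such that $\sigma(i_1)\cdots\sigma(i_k)$ is order-isomorphic to $\tau$ and, setting $i_0=0$, $i_{k+1}=n+1$, letting $v_1<\dots<v_k$ be the values $\sigma(i_1),\dots,\sigma(i_k)$ in increasing order, $v_0=0$, $v_{k+1}=n+1$, for every shaded box $(a,b)\in R$ there is no index $x$ with $i_a<x<i_{a+1}$ and $v_b<\sigma(x)<v_{b+1}$. A permutation avoids $p$ if it has no occurrence of $p$; $S_0(p)$ contains the empty permutation. -}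

module Defs where

open import Data.Nat as ℕ using (ℕ; zero; suc; _<_; _≤_; _!)

open import Data.Integer as ℤ using (ℤ; +_)
open import Data.List using (List; []; _∷_; length; map; upTo)
open import Data.List.Membership.Propositional using (_∈_)
open import Data.List.Relation.Unary.Unique.Propositional using (Unique)
open import Data.List.Relation.Binary.Permutation.Propositional using (_↭_)
open import Data.Product using (Σ; ∃; _×_; _,_)
open import Data.Empty using (⊥)
open import Relation.Nullary using (¬_)
open import Relation.Binary.PropositionalEquality using (_≡_)
open import Function.Bundles using (_⇔_)

-- 1-based lookup: at σ i = σ(i) for 1 ≤ i ≤ length σ, and 0 otherwise.
at : List ℕ → ℕ → ℕ
at []       _             = 0
at (x ∷ xs) zero          = 0
at (x ∷ xs) (suc zero)    = x
at (x ∷ xs) (suc (suc i)) = at xs (suc i)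

oneTo : ℕ → List ℕ
oneTo n = map suc (upTo n)

IsPerm : ℕ → List ℕ → Set
IsPerm n σ = σ ↭ oneTo n

record MeshPattern : Set where
  constructor mesh
  field
    τ : List ℕ                -- a permutation of [k], k = length τ
    R : List (ℕ × ℕ)

-- An occurrence of (τ , R) in σ (σ a permutation of [n], n = length σ).
-- ι a = i_a for 1 ≤ a ≤ k, with ι 0 = i_0 = 0 and ι (k+1) = i_{k+1} = n+1;
-- V b = v_b (the b-th smallest value of the occurrence) for 1 ≤ b ≤ k,
-- with V 0 = 0 and V (k+1) = n+1.  Since the occurrence is order
-- isomorphic to τ, the b-th smallest value is σ(i_a) where τ(a) = b.
record Occurrence (p : MeshPattern) (σ : List ℕ) (ι V : ℕ → ℕ) : Set where
  open MeshPattern p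
  k = length τ
  n = length σ
  field
    ι-first : ι 0 ≡ 0
    ι-last  : ι (suc k) ≡ suc n
    ι-incr  : ∀ a → a ≤ k → ι a < ι (suc a)
    orderIso : ∀ a b → 1 ≤ a → a ≤ k → 1 ≤ b → b ≤ k →
               (at σ (ι a) < at σ (ι b)) ⇔ (at τ a < at τ b)
    V-first : V 0 ≡ 0
    V-last  : V (suc k) ≡ suc n
    V-vals  : ∀ a → 1 ≤ a → a ≤ k → V (at τ a) ≡ at σ (ι a)
    shading : ∀ a b → (a , b) ∈ R → ∀ x →
              ι a < x → x < ι (suc a) →
              V b < at σ x → at σ x < V (suc b) → ⊥

Contains : MeshPattern → List ℕ → Set
Contains p σ = Σ (ℕ → ℕ) λ ι → Σ (ℕ → ℕ) λ V → Occurrence p σ ι V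

Avoids : MeshPattern → List ℕ → Set
Avoids p σ = ¬ Contains p σ

CardAvoiders : MeshPattern → ℕ → ℕ → Set
CardAvoiders p n c =
  Σ (List (List ℕ)) λ L →
    Unique L ×
    (∀ σ → (σ ∈ L) ⇔ (IsPerm n σ × Avoids p σ)) ×
    length L ≡ c

p₀ : MeshPattern
p₀ = mesh (1 ∷ 3 ∷ 2 ∷ [])
          ((0 , 2) ∷ (0 , 3) ∷ (1 , 2) ∷ (1 , 3) ∷ (2 , 0) ∷ (2 , 1) ∷
           (2 , 2) ∷ (2 , 3) ∷ (3 , 1) ∷ (3 , 2) ∷ [])

FPS : Set
FPS = ℕ → ℤ

sumTo : ℕ → (ℕ → ℤ) → ℤ
sumTo zero    f = f 0
sumTo (suc n) f = sumTo n f ℤ.+ f (suc n)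

_⊛_ : FPS → FPS → FPS
(f ⊛ g) n = sumTo n (λ i → f i ℤ.* g (n ℕ.∸ i))

oneS : FPS
oneS zero    = + 1
oneS (suc _) = + 0

xS : FPS
xS 1 = + 1
xS _ = + 0

onePlusX² : FPS
onePlusX² 0 = + 1
onePlusX² 2 = + 1
onePlusX² _ = + 0

_^S_ : FPS → ℕ → FPS
f ^S zero  = oneS
f ^S suc k = f ⊛ (f ^S k)

-- Coefficient of x^n in Σ_{k≥0} k! · g^k, for a series g with g 0 = 0
-- (then g^k has order ≥ k, so only k ≤ n contribute).
sumFactPowers : FPS → FPS
sumFactPowers g n = sumTo n (λ k → (+ (k !)) ℤ.* (g ^S k) n)

-- A permutation σ contains p₀ exactly when it has a hit: adjacent entries σ(t) = P + 2,
-- σ(t + 1) = P + 1 with t ≥ 2 and P the maximum of σ(1), …, σ(t − 1).  Every permutation of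
-- [m + 1] arises uniquely by appending a last value v ∈ [m + 1] to one of [m] (shifting the
-- values ≥ v up), and this breaks at most one hit and creates at most one.  Summing over v,
-- the number E(m, j) of permutations of [m] with a marked set of j hits satisfies
--   E(m + 1, j) = (m + 1 − 2j) E(m, j) + E(m − 1, j − 1),
-- and |S_n(p₀)| = Σ_j (−1)^j E(n, j) by inclusion–exclusion.  On the other side, g = x/(1 + x²)
-- is odd and satisfies (1 + x²) g = x, so the coefficients k! [x^(k+2j)] g^k obey the same
-- recurrence up to the sign (−1)^j and those of x^n with n − k odd vanish.

module Submission where

open import Defs
open import Relation.Binary.PropositionalEquality using (_≡_; refl; cong; trans)

module Hits where

  open import Data.Nat
    using (ℕ; zero; suc; _+_; _*_; _⊔_; _<_; _≤_; z≤n; s≤s; _<?_; _≤?_; _≟_; pred; >-nonZero)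
  open import Data.Nat.Properties
  open import Data.Nat.Tactic.RingSolver using (solve-∀)
  open import Data.List
    using (List; []; _∷_; _++_; [_]; _∷ʳ_; map; length; upTo; filter; cartesianProductWith; initLast; _∷ʳ′_)
  import Data.List.Properties as List
  open import Data.List.Membership.Propositional using (_∈_)
  open import Data.List.Membership.Propositional.Properties
  open import Data.List.Relation.Unary.Any using (here; there)
  open import Data.List.Relation.Unary.All as All using (All; []; _∷_)
  open import Data.List.Relation.Unary.AllPairs using ([]; _∷_)
  open import Data.List.Relation.Unary.Unique.Propositional using (Unique)
  import Data.List.Relation.Unary.Unique.Propositional.Properties as Unique
  open import Data.List.Relation.Binary.Permutation.Propositional
    using (_↭_; ↭-refl; ↭-sym; ↭-trans; ↭-reflexive; swap; ↭⇒↭ₛ)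
  open import Data.List.Relation.Binary.Permutation.Propositional.Properties
    using (++⁺ˡ; ++⁺ʳ; map⁺; drop-mid; ∈-resp-↭; ↭-length; ↭-empty-inv)
  open import Data.Product using (Σ; _×_; _,_; proj₁; proj₂)
  open import Data.Sum using (_⊎_; inj₁; inj₂)
  open import Data.Empty using (⊥; ⊥-elim)
  open import Relation.Nullary using (¬_; Dec; yes; no)
  open import Relation.Nullary.Decidable using (True; toWitness; decidable-stable)
  open import Relation.Binary.Definitions using (tri<; tri≈; tri>)
  open import Relation.Binary.PropositionalEquality hiding ([_])
  open import Data.List.Relation.Binary.Permutation.Setoid.Properties (setoid ℕ) using (Unique-resp-↭)
  import Data.List.Relation.Binary.Permutation.Propositional as Permutation
  open import Function using (_∘_)
  open import Function.Bundles using (_⇔_; mk⇔; Equivalence)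
  open import Data.Product.Properties using (≡-dec)
  open import Data.List.Membership.DecPropositional (≡-dec _≟_ _≟_) using (_∈?_)
  open import Algebra.Properties.CommutativeSemigroup +-commutativeSemigroup
    using () renaming (interchange to +-interchange)

  -- Generating permutations by appending a last value

  shiftFrom : ℕ → ℕ → ℕ
  shiftFrom v x with x <? v
  ... | yes _ = x
  ... | no  _ = suc x

  unshiftFrom : ℕ → ℕ → ℕ
  unshiftFrom v x with x ≤? v
  ... | yes _ = x
  ... | no  _ = pred x

  shiftFrom-< : ∀ {v x} → x < v → shiftFrom v x ≡ x
  shiftFrom-< {v} {x} x<v with x <? v
  ... | yes _   = refl
  ... | no  x≮v = ⊥-elim (x≮v x<v)

  shiftFrom-≥ : ∀ {v x} → v ≤ x → shiftFrom v x ≡ suc x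
  shiftFrom-≥ {v} {x} v≤x with x <? v
  ... | yes x<v = ⊥-elim (<⇒≱ x<v v≤x)
  ... | no  _   = refl

  shiftFrom-injective : ∀ v {x y} → shiftFrom v x ≡ shiftFrom v y → x ≡ y
  shiftFrom-injective v {x} {y} eq with x <? v | y <? v
  ... | yes _   | yes _   = eq
  ... | no  _   | no  _   = suc-injective eq
  ... | yes x<v | no  y≮v = ⊥-elim (y≮v (≤-trans (n≤1+n _) (subst (_< v) eq x<v)))
  ... | no  x≮v | yes y<v = ⊥-elim (x≮v (≤-trans (n≤1+n _) (subst (_< v) (sym eq) y<v)))

  shiftFrom≢ : ∀ v x → shiftFrom v x ≢ v
  shiftFrom≢ v x eq with x <? v
  ... | yes x<v = <-irrefl eq x<v
  ... | no  x≮v = x≮v (≤-reflexive eq)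

  shiftFrom-mono-≤ : ∀ v {x y} → x ≤ y → shiftFrom v x ≤ shiftFrom v y
  shiftFrom-mono-≤ v {x} {y} x≤y with x <? v | y <? v
  ... | yes _   | yes _   = x≤y
  ... | yes _   | no  _   = m≤n⇒m≤1+n x≤y
  ... | no  x≮v | yes y<v = ⊥-elim (x≮v (≤-<-trans x≤y y<v))
  ... | no  _   | no  _   = s≤s x≤y

  shiftFrom-distrib-⊔ : ∀ v x y → shiftFrom v (x ⊔ y) ≡ shiftFrom v x ⊔ shiftFrom v y
  shiftFrom-distrib-⊔ v = mono-≤-distrib-⊔ (shiftFrom-mono-≤ v)

  unshiftFrom-shiftFrom : ∀ v x → unshiftFrom v (shiftFrom v x) ≡ x
  unshiftFrom-shiftFrom v x with x <? v
  ... | yes x<v with x ≤? v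
  ...   | yes _   = refl
  ...   | no  x≰v = ⊥-elim (x≰v (<⇒≤ x<v))
  unshiftFrom-shiftFrom v x | no x≮v with suc x ≤? v
  ...   | yes x<v = ⊥-elim (x≮v x<v)
  ...   | no  _   = refl

  shiftFrom-unshiftFrom : ∀ v x → x ≢ v → shiftFrom v (unshiftFrom v x) ≡ x
  shiftFrom-unshiftFrom v x x≢v with x ≤? v
  ... | yes x≤v = shiftFrom-< (≤∧≢⇒< x≤v x≢v)
  shiftFrom-unshiftFrom v zero    x≢v | no x≰v = ⊥-elim (x≰v z≤n)
  shiftFrom-unshiftFrom v (suc x) x≢v | no x≰v = shiftFrom-≥ (≤-pred (≰⇒> x≰v))

  extend : List ℕ → ℕ → List ℕ
  extend σ v = map (shiftFrom v) σ ∷ʳ v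

  extend-injective : ∀ {σ τ v w} → extend σ v ≡ extend τ w → σ ≡ τ × v ≡ w
  extend-injective {σ} {τ} {v} eq with List.∷ʳ-injective (map (shiftFrom v) σ) _ eq
  ... | eq′ , refl = List.map-injective (shiftFrom-injective v) eq′ , refl

  permutations : ℕ → List (List ℕ)
  permutations zero    = [ [] ]
  permutations (suc m) = cartesianProductWith extend (permutations m) (oneTo (suc m))

  Unique-oneTo : ∀ n → Unique (oneTo n)
  Unique-oneTo n = Unique.map⁺ suc-injective (Unique.upTo⁺ n)

  Unique-permutations : ∀ n → Unique (permutations n)
  Unique-permutations zero    = [] ∷ []
  Unique-permutations (suc m) =
    Unique.cartesianProductWith⁺ extend extend-injective (Unique-permutations m) (Unique-oneTo (suc m))

  ∈-oneTo⁻ : ∀ {v n} → v ∈ oneTo n → 1 ≤ v × v ≤ n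
  ∈-oneTo⁻ v∈ with _ , i∈ , refl ← ∈-map⁻ suc v∈ = s≤s z≤n , ∈-upTo⁻ i∈

  ∈-oneTo⁺ : ∀ {v n} → 1 ≤ v → v ≤ n → v ∈ oneTo n
  ∈-oneTo⁺ {suc v} _ v≤n = ∈-map⁺ suc (∈-upTo⁺ v≤n)

  length-oneTo : ∀ n → length (oneTo n) ≡ n
  length-oneTo n = trans (List.length-map suc (upTo n)) (List.length-upTo n)

  oneTo-suc : ∀ m → oneTo (suc m) ≡ oneTo m ∷ʳ suc m
  oneTo-suc m = trans (cong (map suc) (sym (List.upTo-∷ʳ m))) (List.map-++ suc (upTo m) [ m ])

  map-shiftFrom-oneTo : ∀ {v} m → m < v → map (shiftFrom v) (oneTo m) ≡ oneTo m
  map-shiftFrom-oneTo zero    _   = refl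
  map-shiftFrom-oneTo {v} (suc m) m<v = begin
    map (shiftFrom v) (oneTo (suc m))                  ≡⟨ cong (map (shiftFrom v)) (oneTo-suc m) ⟩
    map (shiftFrom v) (oneTo m ∷ʳ suc m)               ≡⟨ List.map-++ (shiftFrom v) (oneTo m) _ ⟩
    map (shiftFrom v) (oneTo m) ∷ʳ shiftFrom v (suc m) ≡⟨ cong₂ _∷ʳ_ (map-shiftFrom-oneTo m (<⇒≤ m<v)) (shiftFrom-< m<v) ⟩
    oneTo m ∷ʳ suc m                                 ≡⟨ oneTo-suc m ⟨
    oneTo (suc m)                                    ∎
    where open ≡-Reasoning

  extend-oneTo : ∀ m {v} → 1 ≤ v → v ≤ suc m → extend (oneTo m) v ↭ oneTo (suc m)
  extend-oneTo m {v} 1≤v v≤1+m with v ≟ suc m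
  ... | yes refl = ↭-reflexive (trans (cong (_∷ʳ suc m) (map-shiftFrom-oneTo m ≤-refl)) (sym (oneTo-suc m)))
  extend-oneTo zero    1≤v v≤1 | no v≢1 = ⊥-elim (v≢1 (≤-antisym v≤1 1≤v))
  extend-oneTo (suc m) {v} 1≤v v≤2+m | no v≢2+m = begin
    map (shiftFrom v) (oneTo (suc m)) ∷ʳ v       ≡⟨ cong (_∷ʳ v) shifted ⟩
    (shifted-oneTo ∷ʳ suc (suc m)) ∷ʳ v           ≡⟨ List.++-assoc shifted-oneTo _ _ ⟩
    shifted-oneTo ++ (suc (suc m) ∷ v ∷ [])       ↭⟨ ++⁺ˡ shifted-oneTo (swap (suc (suc m)) v ↭-refl) ⟩
    shifted-oneTo ++ (v ∷ suc (suc m) ∷ [])       ≡⟨ List.++-assoc shifted-oneTo [ v ] _ ⟨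
    extend (oneTo m) v ∷ʳ suc (suc m)             ↭⟨ ++⁺ʳ _ (extend-oneTo m 1≤v v≤1+m) ⟩
    oneTo (suc m) ∷ʳ suc (suc m)                  ≡⟨ oneTo-suc (suc m) ⟨
    oneTo (suc (suc m))                           ∎
    where
    open Permutation.PermutationReasoning
    v≤1+m = ≤-pred (≤∧≢⇒< v≤2+m v≢2+m)
    shifted-oneTo = map (shiftFrom v) (oneTo m)
    shifted : map (shiftFrom v) (oneTo (suc m)) ≡ shifted-oneTo ∷ʳ suc (suc m)
    shifted = trans (cong (map (shiftFrom v)) (oneTo-suc m))
                    (trans (List.map-++ (shiftFrom v) (oneTo m) _) (cong (λ z → shifted-oneTo ∷ʳ z) (shiftFrom-≥ v≤1+m)))

  permutations-sound : ∀ n {σ} → σ ∈ permutations n → σ ↭ oneTo n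
  permutations-sound zero    (here refl) = ↭-refl
  permutations-sound (suc m) σ∈
    with τ , v , τ∈ , v∈ , refl ← ∈-cartesianProductWith⁻ extend (permutations m) (oneTo (suc m)) σ∈
    with 1≤v , v≤ ← ∈-oneTo⁻ v∈
    = ↭-trans (++⁺ʳ [ v ] (map⁺ (shiftFrom v) (permutations-sound m τ∈))) (extend-oneTo m 1≤v v≤)

  -- Deleting the last value v of σ and closing the gap it leaves inverts extend.
  permutations-complete : ∀ n {σ} → σ ↭ oneTo n → σ ∈ permutations n
  permutations-complete zero    σ↭ rewrite ↭-empty-inv σ↭ = here refl
  permutations-complete (suc m) {σ} σ↭ with initLast σ
  ... | [] = ⊥-elim (0≢1+n (↭-length σ↭))
  ... | xs ∷ʳ′ v = subst (_∈ permutations (suc m)) (cong (_∷ʳ v) shift-unshift)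
    (∈-cartesianProductWith⁺ extend (permutations-complete m unshifted↭) v∈)
    where
    v∈ : v ∈ oneTo (suc m)
    v∈ = ∈-resp-↭ σ↭ (∈-++⁺ʳ xs (here refl))
    xs↭ : xs ↭ map (shiftFrom v) (oneTo m)
    xs↭ = ↭-trans (↭-reflexive (sym (List.++-identityʳ xs)))
            (↭-trans (drop-mid xs _ (↭-trans σ↭ (↭-sym (extend-oneTo m 1≤v v≤1+m))))
                     (↭-reflexive (List.++-identityʳ _)))
      where
      1≤v = proj₁ (∈-oneTo⁻ v∈)
      v≤1+m = proj₂ (∈-oneTo⁻ v∈)
    unshifted↭ : map (unshiftFrom v) xs ↭ oneTo m
    unshifted↭ = ↭-trans (map⁺ (unshiftFrom v) xs↭)
      (↭-reflexive (trans (sym (List.map-∘ (oneTo m)))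
                          (trans (List.map-cong (unshiftFrom-shiftFrom v) (oneTo m)) (List.map-id (oneTo m)))))
    shift-unshift : map (shiftFrom v) (map (unshiftFrom v) xs) ≡ xs
    shift-unshift = trans (sym (List.map-∘ xs))
                          (List.map-id-local (All.tabulate (λ x∈ → shiftFrom-unshiftFrom v _ (avoids x∈))))
      where
      avoids : ∀ {x} → x ∈ xs → x ≢ v
      avoids x∈ with y , _ , refl ← ∈-map⁻ (shiftFrom v) (∈-resp-↭ xs↭ x∈) = shiftFrom≢ v y

  -- Hits

  δ : ℕ → ℕ → ℕ
  δ zero    zero    = 1
  δ zero    (suc b) = 0
  δ (suc a) zero    = 0
  δ (suc a) (suc b) = δ a b

  δ-refl : ∀ a → δ a a ≡ 1
  δ-refl zero    = refl
  δ-refl (suc a) = δ-refl a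

  δ-≢ : ∀ {a b} → a ≢ b → δ a b ≡ 0
  δ-≢ {zero}  {zero}  a≢b = ⊥-elim (a≢b refl)
  δ-≢ {zero}  {suc b} a≢b = refl
  δ-≢ {suc a} {zero}  a≢b = refl
  δ-≢ {suc a} {suc b} a≢b = δ-≢ (a≢b ∘ cong suc)

  δ≤1 : ∀ a b → δ a b ≤ 1
  δ≤1 zero    zero    = ≤-refl
  δ≤1 zero    (suc b) = z≤n
  δ≤1 (suc a) zero    = z≤n
  δ≤1 (suc a) (suc b) = δ≤1 a b

  δ-≢0 : ∀ {a b} → δ a b ≢ 0 → a ≡ b
  δ-≢0 {a} {b} δ≢0 with a ≟ b
  ... | yes a≡b = a≡b
  ... | no  a≢b = ⊥-elim (δ≢0 (δ-≢ a≢b))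

  -- M is the maximum of the entries to the left of x.
  isHit : ℕ → ℕ → ℕ → ℕ
  isHit M x y = δ x (2 + M) * δ y (1 + M)

  hitsFrom : ℕ → List ℕ → ℕ
  hitsFrom M []          = 0
  hitsFrom M (x ∷ [])    = 0
  hitsFrom M (x ∷ y ∷ r) = isHit M x y + hitsFrom (M ⊔ x) (y ∷ r)

  -- The first entry cannot start a hit: it has no smaller entry to its left.
  hits : List ℕ → ℕ
  hits []       = 0
  hits (x ∷ xs) = hitsFrom x xs

  isHit≤1 : ∀ M x y → isHit M x y ≤ 1
  isHit≤1 M x y = *-mono-≤ (δ≤1 x (2 + M)) (δ≤1 y (1 + M))

  isHit-≢ : ∀ M {x} y → x ≢ 2 + M → isHit M x y ≡ 0
  isHit-≢ M y x≢ = cong (_* δ y (1 + M)) (δ-≢ x≢)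

  isHit-≢0 : ∀ M x y → isHit M x y ≢ 0 → x ≡ 2 + M × y ≡ 1 + M
  isHit-≢0 M x y hit≢0 =
    δ-≢0 (λ δ≡0 → hit≢0 (cong (_* δ y (1 + M)) δ≡0)) ,
    δ-≢0 (λ δ≡0 → hit≢0 (trans (cong (δ x (2 + M) *_) δ≡0) (*-zeroʳ (δ x (2 + M)))))

  hitsFrom≤length : ∀ M xs → hitsFrom M xs ≤ length xs
  hitsFrom≤length M []          = z≤n
  hitsFrom≤length M (x ∷ [])    = z≤n
  hitsFrom≤length M (x ∷ y ∷ r) = +-mono-≤ (isHit≤1 M x y) (hitsFrom≤length (M ⊔ x) (y ∷ r))

  hits≤length : ∀ σ → hits σ ≤ length σ
  hits≤length []       = z≤n
  hits≤length (x ∷ xs) = m≤n⇒m≤1+n (hitsFrom≤length x xs)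

  -- Appending a last value v breaks a hit M + 2, M + 1 when v ∈ {M + 1, M + 2}, and creates
  -- one when v and the old last entry both exceed the maximum before that entry by one.

  inHitRange : ℕ → ℕ → ℕ
  inHitRange M v = δ v (1 + M) + δ v (2 + M)

  hitsBrokenBy : ℕ → ℕ → List ℕ → ℕ
  hitsBrokenBy M v []          = 0
  hitsBrokenBy M v (x ∷ [])    = 0
  hitsBrokenBy M v (x ∷ y ∷ r) = isHit M x y * inHitRange M v + hitsBrokenBy (M ⊔ x) v (y ∷ r)

  hitCreatedBy : ℕ → ℕ → List ℕ → ℕ
  hitCreatedBy M v []          = 0
  hitCreatedBy M v (z ∷ [])    = δ z (1 + M) * δ v (1 + M)
  hitCreatedBy M v (x ∷ y ∷ r) = hitCreatedBy (M ⊔ x) v (y ∷ r)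

  δ-shiftFrom : ∀ c {v} M x → v ≤ M ⊎ c + M < v → δ (shiftFrom v x) (c + shiftFrom v M) ≡ δ x (c + M)
  δ-shiftFrom c {v} M x (inj₁ v≤M) rewrite shiftFrom-≥ v≤M | +-suc c M with x <? v
  ... | yes x<v = trans (δ-≢ (λ eq → <-irrefl eq (<-≤-trans x<v (m≤n⇒m≤1+n (≤-trans v≤M (m≤n+m M c))))))
                        (sym (δ-≢ (λ eq → <-irrefl eq (<-≤-trans x<v (≤-trans v≤M (m≤n+m M c))))))
  ... | no  _   = refl
  δ-shiftFrom c {v} M x (inj₂ c+M<v) rewrite shiftFrom-< (≤-<-trans (m≤n+m M c) c+M<v) with x <? v
  ... | yes _   = refl
  ... | no  x≮v = trans (δ-≢ (λ eq → x≮v (≤-trans (n≤1+n _) (subst (_≤ v) (sym eq) c+M<v))))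
                        (sym (δ-≢ (λ eq → x≮v (subst (_< v) (sym eq) c+M<v))))

  δ-shiftFrom-≡ : ∀ c {M} x → 1 ≤ c → δ (shiftFrom (c + M) x) (c + shiftFrom (c + M) M) ≡ 0
  δ-shiftFrom-≡ (suc c) {M} x _ rewrite shiftFrom-< {suc c + M} (s≤s (m≤n+m M c)) = δ-≢ (shiftFrom≢ (suc c + M) x)

  2+M<v : ∀ {v M} → ¬ v ≤ M → v ≢ 1 + M → v ≢ 2 + M → 2 + M < v
  2+M<v v≰M v≢1+M v≢2+M = ≤∧≢⇒< (≤∧≢⇒< (≰⇒> v≰M) (v≢1+M ∘ sym)) (v≢2+M ∘ sym)

  isHit-shiftFrom : ∀ v M x y →
    isHit (shiftFrom v M) (shiftFrom v x) (shiftFrom v y) + isHit M x y * inHitRange M v ≡ isHit M x y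
  isHit-shiftFrom v M x y with v ≤? M
  ... | yes v≤M
    rewrite δ-shiftFrom 2 M x (inj₁ v≤M) | δ-shiftFrom 1 M y (inj₁ v≤M)
          | δ-≢ {v} {1 + M} (λ eq → <-irrefl eq (s≤s v≤M))
          | δ-≢ {v} {2 + M} (λ eq → <-irrefl eq (m≤n⇒m≤1+n (s≤s v≤M)))
    = trans (cong (isHit M x y +_) (*-zeroʳ (isHit M x y))) (+-identityʳ _)
  ... | no v≰M with v ≟ 1 + M | v ≟ 2 + M
  ...   | yes refl | _
    rewrite δ-shiftFrom-≡ 1 {M} y ≤-refl | δ-refl M | δ-≢ {M} {suc M} (λ eq → <-irrefl eq (n<1+n M))
    = trans (cong (_+ isHit M x y * 1) (*-zeroʳ (δ (shiftFrom (suc M) x) (2 + shiftFrom (suc M) M)))) (*-identityʳ _)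
  ...   | no _ | yes refl
    rewrite δ-shiftFrom-≡ 2 {M} x (s≤s z≤n) | δ-refl M | δ-≢ {suc M} {M} (λ eq → <-irrefl (sym eq) (n<1+n M))
    = *-identityʳ _
  ...   | no v≢1+M | no v≢2+M
    rewrite δ-shiftFrom 2 M x (inj₂ (2+M<v v≰M v≢1+M v≢2+M))
          | δ-shiftFrom 1 M y (inj₂ (<-trans (n<1+n _) (2+M<v v≰M v≢1+M v≢2+M)))
          | δ-≢ v≢1+M | δ-≢ v≢2+M
    = trans (cong (isHit M x y +_) (*-zeroʳ (isHit M x y))) (+-identityʳ _)

  isHit-shiftFrom-last : ∀ v M z → isHit (shiftFrom v M) (shiftFrom v z) v ≡ δ z (1 + M) * δ v (1 + M)
  isHit-shiftFrom-last v M z with v ≤? M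
  ... | yes v≤M
    rewrite shiftFrom-≥ v≤M
          | δ-≢ {v} {2 + M} (λ eq → <-irrefl eq (m≤n⇒m≤1+n (s≤s v≤M)))
          | δ-≢ {v} {1 + M} (λ eq → <-irrefl eq (s≤s v≤M))
    = trans (*-zeroʳ (δ (shiftFrom v z) (2 + suc M))) (sym (*-zeroʳ (δ z (1 + M))))
  ... | no v≰M rewrite shiftFrom-< (≰⇒> v≰M) with v ≟ 1 + M
  ...   | no v≢1+M rewrite δ-≢ v≢1+M = trans (*-zeroʳ (δ (shiftFrom v z) (2 + M))) (sym (*-zeroʳ (δ z (1 + M))))
  ...   | yes refl rewrite δ-refl M with z <? suc M
  ...     | yes z<v = cong (_* 1) (trans (δ-≢ (λ eq → <-irrefl eq (m≤n⇒m≤1+n z<v))) (sym (δ-≢ (λ eq → <-irrefl eq z<v))))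
  ...     | no  _   = refl

  hitsFrom-extend : ∀ v M xs →
    hitsFrom (shiftFrom v M) (map (shiftFrom v) xs ∷ʳ v) + hitsBrokenBy M v xs ≡ hitsFrom M xs + hitCreatedBy M v xs
  hitsFrom-extend v M []          = refl
  hitsFrom-extend v M (z ∷ [])    = trans (+-identityʳ _) (trans (+-identityʳ _) (isHit-shiftFrom-last v M z))
  hitsFrom-extend v M (x ∷ y ∷ r) = begin
    (isHit M′ x′ y′ + hitsFrom (M′ ⊔ x′) rest′) + (isHit M x y * inHitRange M v + hitsBrokenBy (M ⊔ x) v (y ∷ r))
      ≡⟨ cong (λ N → (isHit M′ x′ y′ + hitsFrom N rest′) + broken) (shiftFrom-distrib-⊔ v M x) ⟨
    (isHit M′ x′ y′ + hitsFrom (shiftFrom v (M ⊔ x)) rest′) + (isHit M x y * inHitRange M v + hitsBrokenBy (M ⊔ x) v (y ∷ r))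
      ≡⟨ +-interchange (isHit M′ x′ y′) _ _ _ ⟩
    (isHit M′ x′ y′ + isHit M x y * inHitRange M v) + (hitsFrom (shiftFrom v (M ⊔ x)) rest′ + hitsBrokenBy (M ⊔ x) v (y ∷ r))
      ≡⟨ cong₂ _+_ (isHit-shiftFrom v M x y) (hitsFrom-extend v (M ⊔ x) (y ∷ r)) ⟩
    isHit M x y + (hitsFrom (M ⊔ x) (y ∷ r) + hitCreatedBy (M ⊔ x) v (y ∷ r))
      ≡⟨ +-assoc (isHit M x y) _ _ ⟨
    isHit M x y + hitsFrom (M ⊔ x) (y ∷ r) + hitCreatedBy (M ⊔ x) v (y ∷ r)
      ∎
    where
    open ≡-Reasoning
    M′ = shiftFrom v M
    x′ = shiftFrom v x
    y′ = shiftFrom v y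
    rest′ = map (shiftFrom v) (y ∷ r) ∷ʳ v
    broken = isHit M x y * inHitRange M v + hitsBrokenBy (M ⊔ x) v (y ∷ r)

  ∑ : ∀ {A : Set} → List A → (A → ℕ) → ℕ
  ∑ []       f = 0
  ∑ (x ∷ xs) f = f x + ∑ xs f

  ∑-++ : ∀ {A : Set} (xs ys : List A) f → ∑ (xs ++ ys) f ≡ ∑ xs f + ∑ ys f
  ∑-++ []       ys f = refl
  ∑-++ (x ∷ xs) ys f = trans (cong (f x +_) (∑-++ xs ys f)) (sym (+-assoc (f x) _ _))

  ∑-cong∈ : ∀ {A : Set} (xs : List A) {f g} → (∀ {x} → x ∈ xs → f x ≡ g x) → ∑ xs f ≡ ∑ xs g
  ∑-cong∈ []       f≗g = refl
  ∑-cong∈ (x ∷ xs) f≗g = cong₂ _+_ (f≗g (here refl)) (∑-cong∈ xs (f≗g ∘ there))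

  ∑-cong : ∀ {A : Set} (xs : List A) {f g} → (∀ x → f x ≡ g x) → ∑ xs f ≡ ∑ xs g
  ∑-cong xs f≗g = ∑-cong∈ xs (λ {x} _ → f≗g x)

  ∑-zero : ∀ {A : Set} (xs : List A) {f} → (∀ x → f x ≡ 0) → ∑ xs f ≡ 0
  ∑-zero []       f≗0 = refl
  ∑-zero (x ∷ xs) f≗0 = cong₂ _+_ (f≗0 x) (∑-zero xs f≗0)

  ∑-distrib-+ : ∀ {A : Set} (xs : List A) f g → ∑ xs (λ x → f x + g x) ≡ ∑ xs f + ∑ xs g
  ∑-distrib-+ []       f g = refl
  ∑-distrib-+ (x ∷ xs) f g = trans (cong (f x + g x +_) (∑-distrib-+ xs f g)) (+-interchange (f x) (g x) _ _)

  ∑-*ˡ : ∀ {A : Set} (xs : List A) c f → ∑ xs (λ x → c * f x) ≡ c * ∑ xs f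
  ∑-*ˡ []       c f = sym (*-zeroʳ c)
  ∑-*ˡ (x ∷ xs) c f = trans (cong (c * f x +_) (∑-*ˡ xs c f)) (sym (*-distribˡ-+ c (f x) _))

  ∑-*ʳ : ∀ {A : Set} (xs : List A) c f → ∑ xs (λ x → f x * c) ≡ ∑ xs f * c
  ∑-*ʳ xs c f = trans (∑-cong xs (λ x → *-comm (f x) c)) (trans (∑-*ˡ xs c f) (*-comm c _))

  ∑-const : ∀ {A : Set} (xs : List A) c → ∑ xs (λ _ → c) ≡ length xs * c
  ∑-const []       c = refl
  ∑-const (x ∷ xs) c = cong (c +_) (∑-const xs c)

  ∑-map : ∀ {A B : Set} (h : A → B) xs f → ∑ (map h xs) f ≡ ∑ xs (f ∘ h)
  ∑-map h []       f = refl
  ∑-map h (x ∷ xs) f = cong (f (h x) +_) (∑-map h xs f)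

  ∑-cartesianProductWith : ∀ {A B C : Set} (g : A → B → C) xs ys f →
    ∑ (cartesianProductWith g xs ys) f ≡ ∑ xs (λ x → ∑ ys (λ y → f (g x y)))
  ∑-cartesianProductWith g []       ys f = refl
  ∑-cartesianProductWith g (x ∷ xs) ys f =
    trans (∑-++ (map (g x) ys) _ f) (cong₂ _+_ (∑-map (g x) ys f) (∑-cartesianProductWith g xs ys f))

  length-filter-≟0 : ∀ {A : Set} (f : A → ℕ) xs → length (filter (λ x → f x ≟ 0) xs) ≡ ∑ xs (λ x → δ (f x) 0)
  length-filter-≟0 f []       = refl
  length-filter-≟0 f (x ∷ xs) with f x ≟ 0
  ... | yes fx≡0 rewrite List.filter-accept (λ x → f x ≟ 0) {x} {xs} fx≡0 | fx≡0 = cong suc (length-filter-≟0 f xs)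
  ... | no  fx≢0 rewrite List.filter-reject (λ x → f x ≟ 0) {x} {xs} fx≢0 | δ-≢ fx≢0 = length-filter-≟0 f xs

  ∑-oneTo-δ-out : ∀ K {a} (f : ℕ → ℕ) → K < a → ∑ (oneTo K) (λ w → δ w a * f w) ≡ 0
  ∑-oneTo-δ-out zero    f _   = refl
  ∑-oneTo-δ-out (suc K) {a} f K<a = begin
    ∑ (oneTo (suc K)) g                ≡⟨ cong (λ L → ∑ L g) (oneTo-suc K) ⟩
    ∑ (oneTo K ∷ʳ suc K) g             ≡⟨ ∑-++ (oneTo K) [ suc K ] g ⟩
    ∑ (oneTo K) g + (δ (suc K) a * f (suc K) + 0)
      ≡⟨ cong₂ _+_ (∑-oneTo-δ-out K f (<-trans (n<1+n K) K<a))
                   (cong (λ d → d * f (suc K) + 0) (δ-≢ (λ eq → <-irrefl eq K<a))) ⟩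
    0                                  ∎
    where
    open ≡-Reasoning
    g : ℕ → ℕ
    g w = δ w a * f w

  ∑-oneTo-δ : ∀ K {a} (f : ℕ → ℕ) → 1 ≤ a → a ≤ K → ∑ (oneTo K) (λ w → δ w a * f w) ≡ f a
  ∑-oneTo-δ zero    f 1≤a a≤0 = ⊥-elim (<-irrefl refl (≤-trans 1≤a a≤0))
  ∑-oneTo-δ (suc K) {a} f 1≤a a≤1+K = begin
    ∑ (oneTo (suc K)) g                            ≡⟨ cong (λ L → ∑ L g) (oneTo-suc K) ⟩
    ∑ (oneTo K ∷ʳ suc K) g                         ≡⟨ ∑-++ (oneTo K) [ suc K ] g ⟩
    ∑ (oneTo K) g + (δ (suc K) a * f (suc K) + 0)  ≡⟨ last-or-earlier (a ≟ suc K) ⟩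
    f a                                            ∎
    where
    open ≡-Reasoning
    g : ℕ → ℕ
    g w = δ w a * f w
    last-or-earlier : Dec (a ≡ suc K) → ∑ (oneTo K) g + (δ (suc K) a * f (suc K) + 0) ≡ f a
    last-or-earlier (yes refl) = begin
      ∑ (oneTo K) g + (δ (suc K) (suc K) * f (suc K) + 0)
        ≡⟨ cong₂ _+_ (∑-oneTo-δ-out K f ≤-refl) (cong (λ d → d * f (suc K) + 0) (δ-refl K)) ⟩
      f (suc K) + 0 + 0 ≡⟨ trans (+-identityʳ _) (+-identityʳ _) ⟩
      f (suc K) ∎
    last-or-earlier (no a≢1+K) = begin
      ∑ (oneTo K) g + (δ (suc K) a * f (suc K) + 0)
        ≡⟨ cong₂ _+_ (∑-oneTo-δ K f 1≤a (≤-pred (≤∧≢⇒< a≤1+K a≢1+K)))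
                     (cong (λ d → d * f (suc K) + 0) (δ-≢ (a≢1+K ∘ sym))) ⟩
      f a + 0 ≡⟨ +-identityʳ _ ⟩
      f a ∎

  ∑-oneTo-δ₁ : ∀ K {a} → 1 ≤ a → a ≤ K → ∑ (oneTo K) (λ w → δ w a) ≡ 1
  ∑-oneTo-δ₁ K 1≤a a≤K = trans (∑-cong (oneTo K) (λ w → sym (*-identityʳ _))) (∑-oneTo-δ K (λ _ → 1) 1≤a a≤K)

  inHitRange-below : ∀ {M v} → v ≤ M → inHitRange M v ≡ 0
  inHitRange-below {M} {v} v≤M
    rewrite δ-≢ {v} {1 + M} (λ eq → <-irrefl eq (s≤s v≤M))
          | δ-≢ {v} {2 + M} (λ eq → <-irrefl eq (m≤n⇒m≤1+n (s≤s v≤M))) = refl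

  inHitRange-above : ∀ {M v} → 2 + M < v → inHitRange M v ≡ 0
  inHitRange-above {M} {v} 2+M<v
    rewrite δ-≢ {v} {1 + M} (λ eq → <-irrefl (sym eq) (<-trans (n<1+n _) 2+M<v))
          | δ-≢ {v} {2 + M} (λ eq → <-irrefl (sym eq) 2+M<v) = refl

  inHitRange≤1 : ∀ M v → inHitRange M v ≤ 1
  inHitRange≤1 M v with v ≟ 1 + M
  ... | yes refl rewrite δ-refl M | δ-≢ {M} {suc M} (λ eq → <-irrefl eq ≤-refl) = ≤-refl
  ... | no v≢1+M rewrite δ-≢ v≢1+M = δ≤1 v (2 + M)

  hitsBrokenBy-below : ∀ M {v} xs → v ≤ M → hitsBrokenBy M v xs ≡ 0
  hitsBrokenBy-below M []          _   = refl
  hitsBrokenBy-below M (x ∷ [])    _   = refl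
  hitsBrokenBy-below M (x ∷ y ∷ r) v≤M = cong₂ _+_
    (trans (cong (isHit M x y *_) (inHitRange-below v≤M)) (*-zeroʳ (isHit M x y)))
    (hitsBrokenBy-below (M ⊔ x) (y ∷ r) (≤-trans v≤M (m≤m⊔n M x)))

  hitCreatedBy-below : ∀ M {v} xs → v ≤ M → hitCreatedBy M v xs ≡ 0
  hitCreatedBy-below M []          _   = refl
  hitCreatedBy-below M {v} (z ∷ []) v≤M =
    trans (cong (δ z (1 + M) *_) (δ-≢ {v} {1 + M} (λ eq → <-irrefl eq (s≤s v≤M)))) (*-zeroʳ (δ z (1 + M)))
  hitCreatedBy-below M (x ∷ y ∷ r) v≤M = hitCreatedBy-below (M ⊔ x) (y ∷ r) (≤-trans v≤M (m≤m⊔n M x))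

  -- After a hit x = M + 2 the running maximum is at least M + 2, so v can break no later hit.
  hitsBrokenBy≤1 : ∀ M v xs → hitsBrokenBy M v xs ≤ 1
  hitsBrokenBy≤1 M v []          = z≤n
  hitsBrokenBy≤1 M v (x ∷ [])    = z≤n
  hitsBrokenBy≤1 M v (x ∷ y ∷ r) = first-pair (x ≟ 2 + M) (v ≤? 2 + M) (hitsBrokenBy≤1 (M ⊔ x) v (y ∷ r))
    where
    rest = hitsBrokenBy (M ⊔ x) v (y ∷ r)
    first-pair : Dec (x ≡ 2 + M) → Dec (v ≤ 2 + M) → rest ≤ 1 → isHit M x y * inHitRange M v + rest ≤ 1
    first-pair (no x≢2+M) _ rest≤1 =
      subst (λ h → h * inHitRange M v + rest ≤ 1) (sym (isHit-≢ M y x≢2+M)) rest≤1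
    first-pair (yes refl) (yes v≤2+M) _ =
      subst (λ b → isHit M x y * inHitRange M v + b ≤ 1)
            (sym (hitsBrokenBy-below (M ⊔ x) (y ∷ r) (≤-trans v≤2+M (m≤n⊔m M x))))
            (≤-trans (≤-reflexive (+-identityʳ _)) (*-mono-≤ (isHit≤1 M x y) (inHitRange≤1 M v)))
    first-pair (yes refl) (no v≰2+M) rest≤1 =
      subst (λ c → isHit M x y * c + rest ≤ 1) (sym (inHitRange-above {M} (≰⇒> v≰2+M)))
            (subst (λ h → h + rest ≤ 1) (sym (*-zeroʳ (isHit M x y))) rest≤1)

  hitCreatedBy≤1 : ∀ M v xs → hitCreatedBy M v xs ≤ 1
  hitCreatedBy≤1 M v []          = z≤n
  hitCreatedBy≤1 M v (z ∷ [])    = *-mono-≤ (δ≤1 z (1 + M)) (δ≤1 v (1 + M))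
  hitCreatedBy≤1 M v (x ∷ y ∷ r) = hitCreatedBy≤1 (M ⊔ x) v (y ∷ r)

  hitCreatedBy-≢0 : ∀ M v xs → hitCreatedBy M v xs ≢ 0 → M < v
  hitCreatedBy-≢0 M v xs created≢0 with M <? v
  ... | yes M<v = M<v
  ... | no  M≮v = ⊥-elim (created≢0 (hitCreatedBy-below M xs (≮⇒≥ M≮v)))

  hitCreatedBy⇒¬hitsBrokenBy : ∀ M v xs → hitCreatedBy M v xs ≡ 1 → hitsBrokenBy M v xs ≡ 0
  hitCreatedBy⇒¬hitsBrokenBy M v []          _       = refl
  hitCreatedBy⇒¬hitsBrokenBy M v (z ∷ [])    _       = refl
  hitCreatedBy⇒¬hitsBrokenBy M v (x ∷ y ∷ r) created =
    cong₂ _+_ first-pair (hitCreatedBy⇒¬hitsBrokenBy (M ⊔ x) v (y ∷ r) created)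
    where
    first-pair : isHit M x y * inHitRange M v ≡ 0
    first-pair with x ≟ 2 + M
    ... | no  x≢2+M = cong (_* inHitRange M v) (isHit-≢ M y x≢2+M)
    ... | yes refl  = trans (cong (isHit M (2 + M) y *_) (inHitRange-above below-v)) (*-zeroʳ (isHit M (2 + M) y))
      where
      below-v : 2 + M < v
      below-v = ≤-<-trans (m≤n⊔m M (2 + M)) (hitCreatedBy-≢0 (M ⊔ (2 + M)) v (y ∷ r) (λ eq → 1+n≢0 (trans (sym created) eq)))

  -- Summed over all positions v ∈ [m + 1] of the new value, each hit is broken twice.
  ∑-hitsBrokenBy : ∀ m M xs → All (_≤ m) xs → ∑ (oneTo (suc m)) (λ v → hitsBrokenBy M v xs) ≡ 2 * hitsFrom M xs
  ∑-hitsBrokenBy m M []          _ = ∑-zero (oneTo (suc m)) (λ _ → refl)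
  ∑-hitsBrokenBy m M (x ∷ [])    _ = ∑-zero (oneTo (suc m)) (λ _ → refl)
  ∑-hitsBrokenBy m M (x ∷ y ∷ r) (x≤m ∷ r≤m) = begin
    ∑ V (λ v → isHit M x y * inHitRange M v + hitsBrokenBy (M ⊔ x) v (y ∷ r))
      ≡⟨ ∑-distrib-+ V (λ v → isHit M x y * inHitRange M v) (λ v → hitsBrokenBy (M ⊔ x) v (y ∷ r)) ⟩
    ∑ V (λ v → isHit M x y * inHitRange M v) + ∑ V (λ v → hitsBrokenBy (M ⊔ x) v (y ∷ r))
      ≡⟨ cong₂ _+_ (trans (∑-*ˡ V (isHit M x y) (inHitRange M)) first-pair) (∑-hitsBrokenBy m (M ⊔ x) (y ∷ r) r≤m) ⟩
    2 * isHit M x y + 2 * hitsFrom (M ⊔ x) (y ∷ r)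
      ≡⟨ *-distribˡ-+ 2 (isHit M x y) _ ⟨
    2 * (isHit M x y + hitsFrom (M ⊔ x) (y ∷ r))
      ∎
    where
    open ≡-Reasoning
    V = oneTo (suc m)
    first-pair : isHit M x y * ∑ V (inHitRange M) ≡ 2 * isHit M x y
    first-pair with x ≟ 2 + M
    ... | no x≢2+M rewrite isHit-≢ M y x≢2+M = refl
    ... | yes refl = begin
      isHit M x y * ∑ V (inHitRange M)
        ≡⟨ cong (isHit M x y *_) (∑-distrib-+ V (λ v → δ v (1 + M)) (λ v → δ v (2 + M))) ⟩
      isHit M x y * (∑ V (λ v → δ v (1 + M)) + ∑ V (λ v → δ v (2 + M)))
        ≡⟨ cong (isHit M x y *_) (cong₂ _+_ (∑-oneTo-δ₁ (suc m) (s≤s z≤n) (m≤n⇒m≤1+n (≤-trans (n≤1+n _) x≤m)))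
                                            (∑-oneTo-δ₁ (suc m) (s≤s z≤n) (m≤n⇒m≤1+n x≤m))) ⟩
      isHit M x y * 2
        ≡⟨ *-comm (isHit M x y) 2 ⟩
      2 * isHit M x y
        ∎

  lastIsNextMax : ℕ → List ℕ → ℕ
  lastIsNextMax M []          = 0
  lastIsNextMax M (z ∷ [])    = δ z (1 + M)
  lastIsNextMax M (x ∷ y ∷ r) = lastIsNextMax (M ⊔ x) (y ∷ r)

  endsWithNextMax : List ℕ → ℕ
  endsWithNextMax []       = 0
  endsWithNextMax (x ∷ xs) = lastIsNextMax x xs

  ∑-hitCreatedBy : ∀ m M xs → All (_≤ m) xs → ∑ (oneTo (suc m)) (λ v → hitCreatedBy M v xs) ≡ lastIsNextMax M xs
  ∑-hitCreatedBy m M []          _ = ∑-zero (oneTo (suc m)) (λ _ → refl)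
  ∑-hitCreatedBy m M (z ∷ [])    (z≤m ∷ []) =
    trans (∑-*ˡ (oneTo (suc m)) (δ z (1 + M)) (λ v → δ v (1 + M))) (last (z ≟ 1 + M))
    where
    last : Dec (z ≡ 1 + M) → δ z (1 + M) * ∑ (oneTo (suc m)) (λ v → δ v (1 + M)) ≡ δ z (1 + M)
    last (yes refl) = trans (cong (δ z (1 + M) *_) (∑-oneTo-δ₁ (suc m) (s≤s z≤n) (m≤n⇒m≤1+n z≤m))) (*-identityʳ _)
    last (no z≢1+M) rewrite δ-≢ z≢1+M = refl
  ∑-hitCreatedBy m M (x ∷ y ∷ r) (_ ∷ r≤m) = ∑-hitCreatedBy m (M ⊔ x) (y ∷ r) r≤m

  -- Counting permutations together with a set of j of their hits

  -- Pascal's recursion rather than Data.Nat.Combinatorics._C_, so that small cases compute.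
  binom : ℕ → ℕ → ℕ
  binom n       zero    = 1
  binom zero    (suc k) = 0
  binom (suc n) (suc k) = binom n k + binom n (suc k)

  binomPrev : ℕ → ℕ → ℕ
  binomPrev n zero    = 0
  binomPrev n (suc k) = binom n k

  binom-suc : ∀ n j → binom (suc n) j ≡ binom n j + binomPrev n j
  binom-suc n zero    = refl
  binom-suc n (suc k) = +-comm (binom n k) _

  binom-> : ∀ {o j} → o < j → binom o j ≡ 0
  binom-> {zero}  {suc k} _         = refl
  binom-> {suc o} {suc k} (s≤s o<k) = cong₂ _+_ (binom-> o<k) (binom-> (m<n⇒m<1+n o<k))

  binom-absorb : ∀ p k → suc k * binom (suc p) (suc k) ≡ suc p * binom p k
  binom-absorb zero    zero    = refl
  binom-absorb zero    (suc k) = *-zeroʳ (suc (suc k))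
  binom-absorb (suc q) k = begin
    suc k * (binom (suc q) k + binom (suc q) (suc k))            ≡⟨ *-distribˡ-+ (suc k) (binom (suc q) k) _ ⟩
    suc k * binom (suc q) k + suc k * binom (suc q) (suc k)      ≡⟨ cong (suc k * binom (suc q) k +_) (binom-absorb q k) ⟩
    (binom (suc q) k + k * binom (suc q) k) + suc q * binom q k  ≡⟨ +-assoc (binom (suc q) k) _ _ ⟩
    binom (suc q) k + (k * binom (suc q) k + suc q * binom q k)  ≡⟨ cong (binom (suc q) k +_) (lower k) ⟩
    binom (suc q) k + suc q * binom (suc q) k                    ∎
    where
    open ≡-Reasoning
    lower : ∀ k → k * binom (suc q) k + suc q * binom q k ≡ suc q * binom (suc q) k
    lower zero     = refl
    lower (suc k′) = begin
      suc k′ * binom (suc q) (suc k′) + suc q * binom q (suc k′) ≡⟨ cong (_+ suc q * binom q (suc k′)) (binom-absorb q k′) ⟩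
      suc q * binom q k′ + suc q * binom q (suc k′)              ≡⟨ *-distribˡ-+ (suc q) (binom q k′) _ ⟨
      suc q * binom (suc q) (suc k′)                             ∎

  binomPrev-absorb : ∀ o j → o * binomPrev (pred o) j ≡ j * binom o j
  binomPrev-absorb zero    zero    = refl
  binomPrev-absorb zero    (suc k) = sym (*-zeroʳ (suc k))
  binomPrev-absorb (suc p) zero    = *-zeroʳ (suc p)
  binomPrev-absorb (suc p) (suc k) = sym (binom-absorb p k)

  -- How binom a j changes when a = o − d + e for a broken (d) and a created (e) hit.
  binom-update : ∀ {a o} d e j → a + d ≡ o + e → d ≤ 1 → e ≤ 1 → (e ≡ 1 → d ≡ 0) →
                 binom a j + d * binomPrev (pred o) j ≡ binom o j + e * binomPrev o j
  binom-update {a} {o} 0 0 j a≡o _ _ _ =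
    cong (λ t → binom t j + 0) (trans (sym (+-identityʳ a)) (trans a≡o (+-identityʳ o)))
  binom-update {a} {o} 1 0 j a+1≡o _ _ _ with refl ← trans (+-comm 1 a) (trans a+1≡o (+-identityʳ o)) = begin
    binom a j + (binomPrev a j + 0)  ≡⟨ cong (binom a j +_) (+-identityʳ _) ⟩
    binom a j + binomPrev a j        ≡⟨ binom-suc a j ⟨
    binom (suc a) j                  ≡⟨ +-identityʳ _ ⟨
    binom (suc a) j + 0              ∎
    where open ≡-Reasoning
  binom-update {a} {o} 0 1 j a≡o+1 _ _ _ with refl ← trans (sym (+-identityʳ a)) (trans a≡o+1 (+-comm o 1)) = begin
    binom (suc o) j + 0              ≡⟨ +-identityʳ _ ⟩
    binom (suc o) j                  ≡⟨ binom-suc o j ⟩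
    binom o j + binomPrev o j        ≡⟨ cong (binom o j +_) (+-identityʳ _) ⟨
    binom o j + (binomPrev o j + 0)  ∎
    where open ≡-Reasoning
  binom-update 1 1 j _ _ _ no-both with () ← no-both refl
  binom-update (suc (suc d)) e j _ (s≤s ()) _ _
  binom-update d (suc (suc e)) j _ _ (s≤s ()) _

  ∑-binom-hits-extend : ∀ m σ j → All (_≤ m) σ →
    ∑ (oneTo (suc m)) (λ v → binom (hits (extend σ v)) j) + 2 * (j * binom (hits σ) j)
      ≡ suc m * binom (hits σ) j + endsWithNextMax σ * binomPrev (hits σ) j
  ∑-binom-hits-extend m [] j _ = cong₂ _+_
    (trans (∑-const (oneTo (suc m)) (binom 0 j)) (cong (_* binom 0 j) (length-oneTo (suc m))))
    (cong (2 *_) (trans (sym (binomPrev-absorb 0 j)) refl))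
  ∑-binom-hits-extend m (x ∷ xs) j (_ ∷ xs≤m) = begin
    ∑ V (λ v → binom (after v) j) + 2 * (j * binom o j)
      ≡⟨ cong (∑ V (λ v → binom (after v) j) +_) (trans (*-assoc 2 o _) (cong (2 *_) (binomPrev-absorb o j))) ⟨
    ∑ V (λ v → binom (after v) j) + (2 * o) * binomPrev (pred o) j
      ≡⟨ cong (λ t → ∑ V (λ v → binom (after v) j) + t * binomPrev (pred o) j) (∑-hitsBrokenBy m x xs xs≤m) ⟨
    ∑ V (λ v → binom (after v) j) + ∑ V (λ v → hitsBrokenBy x v xs) * binomPrev (pred o) j
      ≡⟨ cong (∑ V (λ v → binom (after v) j) +_) (∑-*ʳ V (binomPrev (pred o) j) (λ v → hitsBrokenBy x v xs)) ⟨
    ∑ V (λ v → binom (after v) j) + ∑ V (λ v → hitsBrokenBy x v xs * binomPrev (pred o) j)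
      ≡⟨ ∑-distrib-+ V (λ v → binom (after v) j) (λ v → hitsBrokenBy x v xs * binomPrev (pred o) j) ⟨
    ∑ V (λ v → binom (after v) j + hitsBrokenBy x v xs * binomPrev (pred o) j)
      ≡⟨ ∑-cong V (λ v → binom-update (hitsBrokenBy x v xs) (hitCreatedBy x v xs) j (hitsFrom-extend v x xs)
                     (hitsBrokenBy≤1 x v xs) (hitCreatedBy≤1 x v xs) (hitCreatedBy⇒¬hitsBrokenBy x v xs)) ⟩
    ∑ V (λ v → binom o j + hitCreatedBy x v xs * binomPrev o j)
      ≡⟨ ∑-distrib-+ V (λ v → binom o j) (λ v → hitCreatedBy x v xs * binomPrev o j) ⟩
    ∑ V (λ v → binom o j) + ∑ V (λ v → hitCreatedBy x v xs * binomPrev o j)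
      ≡⟨ cong₂ _+_ (trans (∑-const V (binom o j)) (cong (_* binom o j) (length-oneTo (suc m))))
                   (trans (∑-*ʳ V (binomPrev o j) (λ v → hitCreatedBy x v xs)) (cong (_* binomPrev o j) (∑-hitCreatedBy m x xs xs≤m))) ⟩
    suc m * binom o j + lastIsNextMax x xs * binomPrev o j
      ∎
    where
    open ≡-Reasoning
    V = oneTo (suc m)
    o = hitsFrom x xs
    after : ℕ → ℕ
    after v = hitsFrom (shiftFrom v x) (map (shiftFrom v) xs ∷ʳ v)

  permutations-≤ : ∀ m {σ} → σ ∈ permutations m → All (_≤ m) σ
  permutations-≤ m σ∈ = All.tabulate (λ x∈ → proj₂ (∈-oneTo⁻ (∈-resp-↭ (permutations-sound m σ∈) x∈)))

  hits-permutations-≤ : ∀ n {σ} → σ ∈ permutations n → hits σ ≤ n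
  hits-permutations-≤ n {σ} σ∈ =
    ≤-trans (hits≤length σ) (≤-reflexive (trans (↭-length (permutations-sound n σ∈)) (length-oneTo n)))

  -- The number of pairs (σ, J) with σ ∈ S_m and J a set of j hits of σ.
  hitSets : ℕ → ℕ → ℕ
  hitSets m j = ∑ (permutations m) (λ σ → binom (hits σ) j)

  nextMaxHitSets : ℕ → ℕ → ℕ
  nextMaxHitSets m j = ∑ (permutations m) (λ σ → endsWithNextMax σ * binomPrev (hits σ) j)

  hitSets-suc : ∀ m j → hitSets (suc m) j + 2 * (j * hitSets m j) ≡ suc m * hitSets m j + nextMaxHitSets m j
  hitSets-suc m j = begin
    hitSets (suc m) j + 2 * (j * hitSets m j)
      ≡⟨ cong₂ _+_ (∑-cartesianProductWith extend P V (λ σ → binom (hits σ) j))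
                   (sym (trans (∑-*ˡ P 2 (λ σ → j * binom (hits σ) j)) (cong (2 *_) (∑-*ˡ P j (λ σ → binom (hits σ) j))))) ⟩
    ∑ P (λ σ → ∑ V (λ v → binom (hits (extend σ v)) j)) + ∑ P (λ σ → 2 * (j * binom (hits σ) j))
      ≡⟨ ∑-distrib-+ P (λ σ → ∑ V (λ v → binom (hits (extend σ v)) j)) (λ σ → 2 * (j * binom (hits σ) j)) ⟨
    ∑ P (λ σ → ∑ V (λ v → binom (hits (extend σ v)) j) + 2 * (j * binom (hits σ) j))
      ≡⟨ ∑-cong∈ P (λ {σ} σ∈ → ∑-binom-hits-extend m σ j (permutations-≤ m σ∈)) ⟩
    ∑ P (λ σ → suc m * binom (hits σ) j + endsWithNextMax σ * binomPrev (hits σ) j)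
      ≡⟨ ∑-distrib-+ P (λ σ → suc m * binom (hits σ) j) (λ σ → endsWithNextMax σ * binomPrev (hits σ) j) ⟩
    ∑ P (λ σ → suc m * binom (hits σ) j) + nextMaxHitSets m j
      ≡⟨ cong (_+ nextMaxHitSets m j) (∑-*ˡ P (suc m) (λ σ → binom (hits σ) j)) ⟩
    suc m * hitSets m j + nextMaxHitSets m j
      ∎
    where
    open ≡-Reasoning
    P = permutations m
    V = oneTo (suc m)

  runningMax : ℕ → List ℕ → ℕ
  runningMax M []       = M
  runningMax M (x ∷ xs) = runningMax (M ⊔ x) xs

  runningMax-≤ : ∀ {K} M xs → M ≤ K → All (_≤ K) xs → runningMax M xs ≤ K
  runningMax-≤ M []       M≤K _             = M≤K
  runningMax-≤ M (x ∷ xs) M≤K (x≤K ∷ xs≤K) = runningMax-≤ (M ⊔ x) xs (⊔-lub M≤K x≤K) xs≤K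

  runningMax-≥ : ∀ M xs → M ≤ runningMax M xs
  runningMax-≥ M []       = ≤-refl
  runningMax-≥ M (x ∷ xs) = ≤-trans (m≤m⊔n M x) (runningMax-≥ (M ⊔ x) xs)

  ∈⇒≤runningMax : ∀ M xs {y} → y ∈ M ∷ xs → y ≤ runningMax M xs
  ∈⇒≤runningMax M xs       (here refl)         = runningMax-≥ M xs
  ∈⇒≤runningMax M (x ∷ xs) (there (here refl)) = ≤-trans (m≤n⊔m M x) (runningMax-≥ (M ⊔ x) xs)
  ∈⇒≤runningMax M (x ∷ xs) (there (there y∈))  = ∈⇒≤runningMax (M ⊔ x) xs (there y∈)

  δ-suc-shiftFrom : ∀ w M → δ w (suc (shiftFrom w M)) ≡ δ w (suc M)
  δ-suc-shiftFrom w M with w ≤? M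
  ... | yes w≤M rewrite shiftFrom-≥ w≤M =
    trans (δ-≢ {w} {2 + M} (λ eq → <-irrefl eq (m≤n⇒m≤1+n (s≤s w≤M)))) (sym (δ-≢ {w} {1 + M} (λ eq → <-irrefl eq (s≤s w≤M))))
  ... | no  w≰M rewrite shiftFrom-< (≰⇒> w≰M) = refl

  lastIsNextMax-extend : ∀ w M xs → lastIsNextMax (shiftFrom w M) (map (shiftFrom w) xs ∷ʳ w) ≡ δ w (suc (runningMax M xs))
  lastIsNextMax-extend w M []       = δ-suc-shiftFrom w M
  lastIsNextMax-extend w M (y ∷ ys) = begin
    lastIsNextMax (shiftFrom w M) (shiftFrom w y ∷ map (shiftFrom w) ys ∷ʳ w)
      ≡⟨ lastIsNextMax-∷ (shiftFrom w M) (map (shiftFrom w) ys) ⟩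
    lastIsNextMax (shiftFrom w M ⊔ shiftFrom w y) (map (shiftFrom w) ys ∷ʳ w)
      ≡⟨ cong (λ N → lastIsNextMax N (map (shiftFrom w) ys ∷ʳ w)) (shiftFrom-distrib-⊔ w M y) ⟨
    lastIsNextMax (shiftFrom w (M ⊔ y)) (map (shiftFrom w) ys ∷ʳ w)
      ≡⟨ lastIsNextMax-extend w (M ⊔ y) ys ⟩
    δ w (suc (runningMax (M ⊔ y) ys))
      ∎
    where
    open ≡-Reasoning
    lastIsNextMax-∷ : ∀ {x} M L → lastIsNextMax M (x ∷ L ∷ʳ w) ≡ lastIsNextMax (M ⊔ x) (L ∷ʳ w)
    lastIsNextMax-∷ M []      = refl
    lastIsNextMax-∷ M (_ ∷ _) = refl

  extend-above-unchanged : ∀ M {v} xs → M < v → All (_< v) xs → hitsBrokenBy M v xs ≡ 0 × hitCreatedBy M v xs ≡ 0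
  extend-above-unchanged M     []          _   _ = refl , refl
  extend-above-unchanged M {v} (z ∷ [])    M<v (z<v ∷ []) = refl , none-created (v ≟ 1 + M)
    where
    none-created : Dec (v ≡ 1 + M) → δ z (1 + M) * δ v (1 + M) ≡ 0
    none-created (yes refl)   = cong (_* δ (1 + M) (1 + M)) (δ-≢ {z} {1 + M} (λ eq → <-irrefl eq z<v))
    none-created (no v≢1+M) = trans (cong (δ z (1 + M) *_) (δ-≢ v≢1+M)) (*-zeroʳ (δ z (1 + M)))
  extend-above-unchanged M {v} (x ∷ y ∷ r) M<v (x<v ∷ r<v)
    with broken , created ← extend-above-unchanged (M ⊔ x) (y ∷ r) (⊔-lub M<v x<v) r<v
    = cong₂ _+_ first-pair broken , created
    where
    first-pair : isHit M x y * inHitRange M v ≡ 0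
    first-pair with x ≟ 2 + M
    ... | yes refl = trans (cong (isHit M (2 + M) y *_) (inHitRange-above x<v)) (*-zeroʳ (isHit M (2 + M) y))
    ... | no x≢2+M = cong (_* inHitRange M v) (isHit-≢ M y x≢2+M)

  hits-extend-above : ∀ {v} x xs → x < v → All (_< v) xs → hits (extend (x ∷ xs) v) ≡ hits (x ∷ xs)
  hits-extend-above {v} x xs x<v xs<v with broken , created ← extend-above-unchanged x xs x<v xs<v = begin
    after                       ≡⟨ +-identityʳ _ ⟨
    after + 0                   ≡⟨ cong (after +_) broken ⟨
    after + hitsBrokenBy x v xs ≡⟨ hitsFrom-extend v x xs ⟩
    hitsFrom x xs + hitCreatedBy x v xs ≡⟨ cong (hitsFrom x xs +_) created ⟩
    hitsFrom x xs + 0           ≡⟨ +-identityʳ _ ⟩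
    hitsFrom x xs               ∎
    where
    open ≡-Reasoning
    after = hitsFrom (shiftFrom v x) (map (shiftFrom v) xs ∷ʳ v)

  -- Appending to a permutation of [m] ends in a next maximum exactly when the new value is m + 1.
  nextMaxHitSets-suc : ∀ m j → 1 ≤ m → nextMaxHitSets (suc m) (suc j) ≡ hitSets m j
  nextMaxHitSets-suc m j 1≤m =
    trans (∑-cartesianProductWith extend (permutations m) (oneTo (suc m)) (λ σ → endsWithNextMax σ * binomPrev (hits σ) (suc j)))
          (∑-cong∈ (permutations m) appended-max)
    where
    appended-max : ∀ {τ} → τ ∈ permutations m →
      ∑ (oneTo (suc m)) (λ w → endsWithNextMax (extend τ w) * binom (hits (extend τ w)) j) ≡ binom (hits τ) j
    appended-max {[]} τ∈ =
      ⊥-elim (<-irrefl refl (≤-trans 1≤m (≤-reflexive (sym (trans (↭-length (permutations-sound m τ∈)) (length-oneTo m))))))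
    appended-max {x ∷ xs} τ∈ = begin
      ∑ (oneTo (suc m)) (λ w → endsWithNextMax (extend (x ∷ xs) w) * binom (hits (extend (x ∷ xs) w)) j)
        ≡⟨ ∑-cong (oneTo (suc m)) (λ w → cong (_* binom (hits (extend (x ∷ xs) w)) j)
                                              (trans (lastIsNextMax-extend w x xs) (cong (λ t → δ w (suc t)) max≡m))) ⟩
      ∑ (oneTo (suc m)) (λ w → δ w (suc m) * binom (hits (extend (x ∷ xs) w)) j)
        ≡⟨ ∑-oneTo-δ (suc m) (λ w → binom (hits (extend (x ∷ xs) w)) j) (s≤s z≤n) ≤-refl ⟩
      binom (hits (extend (x ∷ xs) (suc m))) j
        ≡⟨ cong (λ t → binom t j) (hits-extend-above x xs (s≤s x≤m) (All.map s≤s xs≤m)) ⟩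
      binom (hits (x ∷ xs)) j
        ∎
      where
      open ≡-Reasoning
      x≤m = All.head (permutations-≤ m τ∈)
      xs≤m = All.tail (permutations-≤ m τ∈)
      max≡m : runningMax x xs ≡ m
      max≡m = ≤-antisym (runningMax-≤ x xs x≤m xs≤m)
                        (∈⇒≤runningMax x xs (∈-resp-↭ (↭-sym (permutations-sound m τ∈)) (∈-oneTo⁺ 1≤m ≤-refl)))

  nextMaxHitSets-zero : ∀ m → nextMaxHitSets m 0 ≡ 0
  nextMaxHitSets-zero m = ∑-zero (permutations m) (λ σ → *-zeroʳ (endsWithNextMax σ))

  hitSets-recurrence : ∀ k j →
    hitSets (suc k + (j + j)) j ≡ suc k * hitSets (k + (j + j)) j + nextMaxHitSets (k + (j + j)) j
  hitSets-recurrence k j = +-cancelʳ-≡ (2 * (j * E)) _ _ (begin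
    hitSets (suc k + (j + j)) j + 2 * (j * E)  ≡⟨ hitSets-suc (k + (j + j)) j ⟩
    suc (k + (j + j)) * E + T                  ≡⟨ regroup (suc k) j E T ⟩
    (suc k * E + T) + 2 * (j * E)              ∎)
    where
    open ≡-Reasoning
    E = hitSets (k + (j + j)) j
    T = nextMaxHitSets (k + (j + j)) j
    regroup : ∀ a j E T → (a + (j + j)) * E + T ≡ (a * E + T) + 2 * (j * E)
    regroup = solve-∀

  hitSets-recurrence-0 : ∀ k → hitSets (suc k + 0) 0 ≡ suc k * hitSets (k + 0) 0
  hitSets-recurrence-0 k =
    trans (hitSets-recurrence k 0) (trans (cong (suc k * hitSets (k + 0) 0 +_) (nextMaxHitSets-zero (k + 0))) (+-identityʳ _))

  k+2[1+i] : ∀ k i → k + (suc i + suc i) ≡ suc (suc (k + (i + i)))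
  k+2[1+i] k i = trans (cong (k +_) (cong suc (+-suc i i))) (trans (+-suc k (suc (i + i))) (cong suc (+-suc k (i + i))))

  hitSets-recurrence-suc : ∀ k i →
    hitSets (suc k + (suc i + suc i)) (suc i) ≡ suc k * hitSets (k + (suc i + suc i)) (suc i) + hitSets (suc k + (i + i)) i
  hitSets-recurrence-suc k i = trans (hitSets-recurrence k (suc i)) (cong (suc k * hitSets (k + (suc i + suc i)) (suc i) +_)
    (trans (cong (λ m → nextMaxHitSets m (suc i)) (k+2[1+i] k i)) (nextMaxHitSets-suc (suc (k + (i + i))) i (s≤s z≤n))))

  -- Every hit needs an entry to its left and occupies two entries, so j hits need 2j + 1 entries.
  hitSets-vanish : ∀ n i → n ≤ suc i + suc i → hitSets n (suc i) ≡ 0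
  hitSets-vanish zero    i _      = refl
  hitSets-vanish (suc m) i 1+m≤ = begin
    hitSets (suc m) (suc i)                                  ≡⟨ +-identityʳ _ ⟨
    hitSets (suc m) (suc i) + 0                              ≡⟨ cong (hitSets (suc m) (suc i) +_) no-term ⟨
    hitSets (suc m) (suc i) + 2 * (suc i * hitSets m (suc i)) ≡⟨ hitSets-suc m (suc i) ⟩
    suc m * hitSets m (suc i) + nextMaxHitSets m (suc i)     ≡⟨ cong₂ (λ e t → suc m * e + t) previous (nextMax m i 1+m≤) ⟩
    suc m * 0 + 0                                            ≡⟨ cong (_+ 0) (*-zeroʳ (suc m)) ⟩
    0                                                        ∎
    where
    open ≡-Reasoning
    previous : hitSets m (suc i) ≡ 0
    previous = hitSets-vanish m i (≤-trans (n≤1+n m) 1+m≤)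
    no-term : 2 * (suc i * hitSets m (suc i)) ≡ 0
    no-term = trans (cong (λ e → 2 * (suc i * e)) previous) (cong (2 *_) (*-zeroʳ (suc i)))
    nextMax : ∀ m i → suc m ≤ suc i + suc i → nextMaxHitSets m (suc i) ≡ 0
    nextMax zero          _       _    = refl
    nextMax (suc zero)    _       _    = refl
    nextMax (suc (suc m)) zero    3+m≤ = ⊥-elim (<-irrefl refl (≤-trans (s≤s (s≤s (s≤s z≤n))) 3+m≤))
    nextMax (suc (suc m)) (suc i) 3+m≤ =
      trans (nextMaxHitSets-suc (suc m) (suc i) (s≤s z≤n))
            (hitSets-vanish (suc m) i (≤-pred (≤-pred (≤-trans 3+m≤ (≤-reflexive (cong suc (+-suc (suc i) (suc i))))))))

  -- Hits as configurations of positions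

  record Hit (σ : List ℕ) : Set where
    field
      t P        : ℕ
      1+t≤length : suc t ≤ length σ
      at-t       : at σ t ≡ 2 + P
      at-1+t     : at σ (suc t) ≡ 1 + P
      prefix≤P   : ∀ p → 1 ≤ p → p < t → at σ p ≤ P
      P-attained : Σ ℕ λ p → 1 ≤ p × p < t × at σ p ≡ P

  Hit-2≤t : ∀ {σ} (h : Hit σ) → 2 ≤ Hit.t h
  Hit-2≤t h with p , 1≤p , p<t , _ ← Hit.P-attained h = ≤-trans (s≤s 1≤p) p<t

  at-skip : ∀ {M x N} L t → 2 ≤ t → at (M ∷ x ∷ L) (suc t) ≡ at (N ∷ L) t
  at-skip L (suc (suc i)) _        = refl
  at-skip L (suc zero)    (s≤s ())

  hit-at-2 : ∀ M x y r → isHit M x y ≢ 0 → Hit (M ∷ x ∷ y ∷ r)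
  hit-at-2 M x y r hit≢0 = record
    { t = 2 ; P = M ; 1+t≤length = s≤s (s≤s (s≤s z≤n))
    ; at-t = proj₁ (isHit-≢0 M x y hit≢0) ; at-1+t = proj₂ (isHit-≢0 M x y hit≢0)
    ; prefix≤P = λ { (suc zero) _ _ → ≤-refl ; (suc (suc p)) _ (s≤s (s≤s ())) }
    ; P-attained = 1 , ≤-refl , s≤s (s≤s z≤n) , refl }

  Hit-merge⁻ : ∀ M x L → Hit ((M ⊔ x) ∷ L) → Hit (M ∷ x ∷ L)
  Hit-merge⁻ M x L h = record
    { t = suc t ; P = P ; 1+t≤length = s≤s 1+t≤length
    ; at-t = trans (at-skip {M} {x} {M ⊔ x} L t 2≤t) at-t
    ; at-1+t = trans (at-skip {M} {x} {M ⊔ x} L (suc t) (m≤n⇒m≤1+n 2≤t)) at-1+t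
    ; prefix≤P = prefix≤P′ ; P-attained = attained′ P-attained }
    where
    open Hit h
    2≤t : 2 ≤ t
    2≤t = Hit-2≤t h
    M⊔x≤P : M ⊔ x ≤ P
    M⊔x≤P = prefix≤P 1 ≤-refl 2≤t
    prefix≤P′ : ∀ p → 1 ≤ p → p < suc t → at (M ∷ x ∷ L) p ≤ P
    prefix≤P′ 1                   _ _         = ≤-trans (m≤m⊔n M x) M⊔x≤P
    prefix≤P′ 2                   _ _         = ≤-trans (m≤n⊔m M x) M⊔x≤P
    prefix≤P′ (suc (suc (suc p))) _ (s≤s p<t) = prefix≤P (suc (suc p)) (s≤s z≤n) p<t
    attained′ : (Σ ℕ λ p → 1 ≤ p × p < t × at ((M ⊔ x) ∷ L) p ≡ P) →
                Σ ℕ λ p → 1 ≤ p × p < suc t × at (M ∷ x ∷ L) p ≡ P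
    attained′ (suc zero , _ , _ , M⊔x≡P) with ⊔-sel M x
    ... | inj₁ M⊔x≡M = 1 , ≤-refl , s≤s (≤-trans (s≤s z≤n) 2≤t) , trans (sym M⊔x≡M) M⊔x≡P
    ... | inj₂ M⊔x≡x = 2 , s≤s z≤n , s≤s 2≤t , trans (sym M⊔x≡x) M⊔x≡P
    attained′ (suc (suc p) , _ , p<t , at≡P) = suc (suc (suc p)) , s≤s z≤n , s≤s p<t , at≡P

  -- The running maximum M acts as an entry at position 1 in front of xs.
  hitsFrom≢0⇒Hit : ∀ M xs → hitsFrom M xs ≢ 0 → Hit (M ∷ xs)
  hitsFrom≢0⇒Hit M []          h≢0 = ⊥-elim (h≢0 refl)
  hitsFrom≢0⇒Hit M (x ∷ [])    h≢0 = ⊥-elim (h≢0 refl)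
  hitsFrom≢0⇒Hit M (x ∷ y ∷ r) h≢0 =
    first-or-later (isHit M x y ≟ 0)
      (λ hit≡0 → hitsFrom≢0⇒Hit (M ⊔ x) (y ∷ r) (h≢0 ∘ trans (cong (_+ hitsFrom (M ⊔ x) (y ∷ r)) hit≡0)))
    where
    first-or-later : Dec (isHit M x y ≡ 0) → (isHit M x y ≡ 0 → Hit ((M ⊔ x) ∷ y ∷ r)) → Hit (M ∷ x ∷ y ∷ r)
    first-or-later (no  hit≢0) _     = hit-at-2 M x y r hit≢0
    first-or-later (yes hit≡0) later = Hit-merge⁻ M x (y ∷ r) (later hit≡0)

  Hit-merge⁺ : ∀ M x L (h : Hit (M ∷ x ∷ L)) → 3 ≤ Hit.t h → Hit ((M ⊔ x) ∷ L)
  Hit-merge⁺ M x L record { t = suc (suc (suc i)) ; P = P ; 1+t≤length = s≤s 1+t≤length ; at-t = at-t ; at-1+t = at-1+t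
                          ; prefix≤P = prefix≤P ; P-attained = P-attained } _ = record
    { t = suc (suc i) ; P = P ; 1+t≤length = 1+t≤length ; at-t = at-t ; at-1+t = at-1+t
    ; prefix≤P = prefix≤P′ ; P-attained = attained′ P-attained }
    where
    x≤P : x ≤ P
    x≤P = prefix≤P 2 (s≤s z≤n) (s≤s (s≤s (s≤s z≤n)))
    M≤P : M ≤ P
    M≤P = prefix≤P 1 ≤-refl (s≤s (s≤s z≤n))
    prefix≤P′ : ∀ p → 1 ≤ p → p < suc (suc i) → at ((M ⊔ x) ∷ L) p ≤ P
    prefix≤P′ 1             _ _  = ⊔-lub M≤P x≤P
    prefix≤P′ (suc (suc q)) _ lt = prefix≤P (suc (suc (suc q))) (s≤s z≤n) (s≤s lt)
    attained′ : (Σ ℕ λ p → 1 ≤ p × p < suc (suc (suc i)) × at (M ∷ x ∷ L) p ≡ P) →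
                Σ ℕ λ p → 1 ≤ p × p < suc (suc i) × at ((M ⊔ x) ∷ L) p ≡ P
    attained′ (1 , _ , _ , M≡P) =
      1 , ≤-refl , s≤s (s≤s z≤n) , trans (m≥n⇒m⊔n≡m (subst (x ≤_) (sym M≡P) x≤P)) M≡P
    attained′ (2 , _ , _ , x≡P) =
      1 , ≤-refl , s≤s (s≤s z≤n) , trans (m≤n⇒m⊔n≡n (subst (M ≤_) (sym x≡P) M≤P)) x≡P
    attained′ (suc (suc (suc q)) , _ , s≤s lt , at≡P) = suc (suc q) , s≤s z≤n , lt , at≡P
  Hit-merge⁺ M x L record { t = 0 }             ()
  Hit-merge⁺ M x L record { t = suc zero }       (s≤s ())
  Hit-merge⁺ M x L record { t = suc (suc zero) } (s≤s (s≤s ()))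

  Hit⇒hitsFrom≢0 : ∀ M xs → Hit (M ∷ xs) → hitsFrom M xs ≢ 0
  Hit⇒hitsFrom≢0 M []          record { t = suc (suc _) ; 1+t≤length = s≤s () }
  Hit⇒hitsFrom≢0 M (x ∷ [])    record { t = suc (suc _) ; 1+t≤length = s≤s (s≤s ()) }
  Hit⇒hitsFrom≢0 M xs          record { t = zero ; P-attained = _ , 1≤p , () , _ }
  Hit⇒hitsFrom≢0 M xs          record { t = suc zero ; P-attained = _ , s≤s _ , s≤s () , _ }
  Hit⇒hitsFrom≢0 M (x ∷ y ∷ r) record { t = 2 ; P-attained = suc (suc _) , _ , s≤s (s≤s ()) , _ }
  Hit⇒hitsFrom≢0 M (x ∷ y ∷ r) record { t = 2 ; at-t = refl ; at-1+t = refl ; P-attained = 1 , _ , _ , refl } sum≡0 =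
    1+n≢0 (trans (cong (_+ hitsFrom (M ⊔ x) (y ∷ r)) (sym hit)) sum≡0)
    where
    hit : isHit M (2 + M) (1 + M) ≡ 1
    hit rewrite δ-refl M = refl
  Hit⇒hitsFrom≢0 M (x ∷ y ∷ r) h@record { t = suc (suc (suc _)) } sum≡0 =
    Hit⇒hitsFrom≢0 (M ⊔ x) (y ∷ r) (Hit-merge⁺ M x (y ∷ r) h (s≤s (s≤s (s≤s z≤n)))) (m+n≡0⇒n≡0 (isHit M x y) sum≡0)

  hits≢0⇒Hit : ∀ σ → hits σ ≢ 0 → Hit σ
  hits≢0⇒Hit []       h≢0 = ⊥-elim (h≢0 refl)
  hits≢0⇒Hit (x ∷ xs) h≢0 = hitsFrom≢0⇒Hit x xs h≢0

  Hit⇒hits≢0 : ∀ σ → Hit σ → hits σ ≢ 0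
  Hit⇒hits≢0 []       record { 1+t≤length = () }
  Hit⇒hits≢0 (x ∷ xs) h = Hit⇒hitsFrom≢0 x xs h

  -- A hit gives the occurrence i₁ < t < t + 1 of p₀, where σ(i₁) = P is attained before t.
  Hit⇒Contains : ∀ {σ} → Hit σ → Contains p₀ σ
  Hit⇒Contains {σ} h with i₁ , 1≤i₁ , i₁<t , at-i₁ ← Hit.P-attained h = ι , V , record
    { ι-first = refl ; ι-last = refl ; ι-incr = ι-incr ; orderIso = orderIso
    ; V-first = refl ; V-last = refl ; V-vals = V-vals ; shading = λ a b m → All.lookup shaded-empty m }
    where
    open Hit h
    n = length σ
    ι V : ℕ → ℕ
    ι 0 = 0
    ι 1 = i₁
    ι 2 = t
    ι 3 = suc t
    ι _ = suc n
    V 0 = 0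
    V 1 = P
    V 2 = suc P
    V 3 = suc (suc P)
    V _ = suc n
    τ = MeshPattern.τ p₀
    value : ∀ a → 1 ≤ a → a ≤ 3 → suc (at σ (ι a)) ≡ at τ a + P
    value 1 _ _ = cong suc at-i₁
    value 2 _ _ = cong suc at-t
    value 3 _ _ = cong suc at-1+t
    value (suc (suc (suc (suc _)))) _ (s≤s (s≤s (s≤s ())))
    orderIso : ∀ a b → 1 ≤ a → a ≤ 3 → 1 ≤ b → b ≤ 3 → (at σ (ι a) < at σ (ι b)) ⇔ (at τ a < at τ b)
    orderIso a b 1≤a a≤3 1≤b b≤3 = mk⇔
      (λ lt → +-cancelʳ-< P (at τ a) (at τ b) (subst₂ _<_ (value a 1≤a a≤3) (value b 1≤b b≤3) (s≤s lt)))
      (λ lt → ≤-pred (subst₂ _<_ (sym (value a 1≤a a≤3)) (sym (value b 1≤b b≤3)) (+-monoˡ-< P lt)))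
    ι-incr : ∀ a → a ≤ 3 → ι a < ι (suc a)
    ι-incr 0 _ = 1≤i₁
    ι-incr 1 _ = i₁<t
    ι-incr 2 _ = ≤-refl
    ι-incr 3 _ = s≤s 1+t≤length
    ι-incr (suc (suc (suc (suc _)))) (s≤s (s≤s (s≤s ())))
    V-vals : ∀ a → 1 ≤ a → a ≤ 3 → V (at τ a) ≡ at σ (ι a)
    V-vals 1 _ _ = sym at-i₁
    V-vals 2 _ _ = sym at-t
    V-vals 3 _ _ = sym at-1+t
    V-vals (suc (suc (suc (suc _)))) _ (s≤s (s≤s (s≤s ())))
    EmptyBox : ℕ → ℕ → Set
    EmptyBox a b = ∀ x → ι a < x → x < ι (suc a) → V b < at σ x → at σ x < V (suc b) → ⊥
    thin-row : ∀ a b → V (suc b) ≡ suc (V b) → EmptyBox a b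
    thin-row a b V≡ x _ _ V<σx σx<V = <⇒≱ V<σx (≤-pred (subst (at σ x <_) V≡ σx<V))
    thin-column : ∀ a b → ι (suc a) ≡ suc (ι a) → EmptyBox a b
    thin-column a b ι≡ x ι<x x<ι _ _ = <⇒≱ ι<x (≤-pred (subst (x <_) ι≡ x<ι))
    below-t : ∀ a → ι (suc a) ≤ t → EmptyBox a 3
    below-t a ι≤t x ι<x x<ι V<σx _ =
      <⇒≱ V<σx (≤-trans (prefix≤P x (≤-trans (s≤s z≤n) ι<x) (<-≤-trans x<ι ι≤t)) (≤-trans (n≤1+n P) (n≤1+n (suc P))))
    shaded-empty : All (λ box → EmptyBox (proj₁ box) (proj₂ box)) (MeshPattern.R p₀)
    shaded-empty =
      thin-row 0 2 refl ∷ below-t 0 (<⇒≤ i₁<t) ∷ thin-row 1 2 refl ∷ below-t 1 ≤-refl ∷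
      thin-column 2 0 refl ∷ thin-column 2 1 refl ∷ thin-column 2 2 refl ∷ thin-column 2 3 refl ∷
      thin-row 3 1 refl ∷ thin-row 3 2 refl ∷ []

  at-∈ : ∀ σ x → 1 ≤ x → x ≤ length σ → at σ x ∈ σ
  at-∈ (s ∷ σ) (suc zero)    _ _         = here refl
  at-∈ (s ∷ σ) (suc (suc i)) _ (s≤s i<n) = there (at-∈ σ (suc i) (s≤s z≤n) i<n)

  ∈⇒at : ∀ σ {v} → v ∈ σ → Σ ℕ λ x → 1 ≤ x × x ≤ length σ × at σ x ≡ v
  ∈⇒at (s ∷ σ) (here refl) = 1 , s≤s z≤n , s≤s z≤n , refl
  ∈⇒at (s ∷ σ) (there v∈) with suc i , _ , i≤n , at≡v ← ∈⇒at σ v∈ = suc (suc i) , s≤s z≤n , s≤s i≤n , at≡v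

  at-injective : ∀ σ → Unique σ → ∀ {x y} →
                 1 ≤ x → x ≤ length σ → 1 ≤ y → y ≤ length σ → at σ x ≡ at σ y → x ≡ y
  at-injective (s ∷ σ) _            {suc zero}    {suc zero}    _ _ _ _ _ = refl
  at-injective (s ∷ σ) (s∉σ ∷ _)    {suc zero}    {suc (suc j)} _ _ _ (s≤s j<n) eq =
    ⊥-elim (All.lookup s∉σ (at-∈ σ (suc j) (s≤s z≤n) j<n) eq)
  at-injective (s ∷ σ) (s∉σ ∷ _)    {suc (suc i)} {suc zero}    _ (s≤s i<n) _ _ eq =
    ⊥-elim (All.lookup s∉σ (at-∈ σ (suc i) (s≤s z≤n) i<n) (sym eq))
  at-injective (s ∷ σ) (_ ∷ unique) {suc (suc i)} {suc (suc j)} _ (s≤s i<n) _ (s≤s j<n) eq =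
    cong suc (at-injective σ unique (s≤s z≤n) i<n (s≤s z≤n) j<n eq)

  module _ {σ N} (σ↭ : σ ↭ oneTo N) where

    length-perm : length σ ≡ N
    length-perm = trans (↭-length σ↭) (length-oneTo N)

    at-perm-range : ∀ {x} → 1 ≤ x → x ≤ length σ → 1 ≤ at σ x × at σ x ≤ length σ
    at-perm-range 1≤x x≤n with 1≤v , v≤N ← ∈-oneTo⁻ (∈-resp-↭ σ↭ (at-∈ σ _ 1≤x x≤n)) =
      1≤v , subst (at σ _ ≤_) (sym length-perm) v≤N

    at-perm-surjective : ∀ {v} → 1 ≤ v → v ≤ length σ → Σ ℕ λ x → 1 ≤ x × x ≤ length σ × at σ x ≡ v
    at-perm-surjective 1≤v v≤n = ∈⇒at σ (∈-resp-↭ (↭-sym σ↭) (∈-oneTo⁺ 1≤v (subst (_ ≤_) length-perm v≤n)))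

    at-perm-injective : ∀ {x y} → 1 ≤ x → x ≤ length σ → 1 ≤ y → y ≤ length σ → x ≢ y → at σ x ≢ at σ y
    at-perm-injective 1≤x x≤n 1≤y y≤n x≢y =
      x≢y ∘ at-injective σ (Unique-resp-↭ (↭⇒↭ₛ (↭-sym σ↭)) (Unique-oneTo N)) 1≤x x≤n 1≤y y≤n

  -- In a permutation, an occurrence i₁ < i₂ < i₃ of p₀ is forced to be a hit:
  -- the shaded column between i₂ and i₃ makes them adjacent, the shaded rows
  -- make σ(i₂) = σ(i₃) + 1 and put P = σ(i₃) − 1 before i₂, and the shading
  -- left of i₂ bounds the prefix by P.
  module OccurrenceToHit {σ N} (σ↭ : σ ↭ oneTo N) {ι V} (O : Occurrence p₀ σ ι V) where
    open Occurrence O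

    L = length σ
    i₁ = ι 1
    i₂ = ι 2
    i₃ = ι 3
    a₁ = at σ i₁
    a₂ = at σ i₂
    a₃ = at σ i₃

    1≤i₁ : 1 ≤ i₁
    1≤i₁ = subst (_< i₁) ι-first (ι-incr 0 z≤n)
    i₁<i₂ : i₁ < i₂
    i₁<i₂ = ι-incr 1 (s≤s z≤n)
    i₂<i₃ : i₂ < i₃
    i₂<i₃ = ι-incr 2 (s≤s (s≤s z≤n))
    i₃≤L : i₃ ≤ L
    i₃≤L = ≤-pred (subst (i₃ <_) ι-last (ι-incr 3 ≤-refl))
    1≤i₂ : 1 ≤ i₂
    1≤i₂ = ≤-trans 1≤i₁ (<⇒≤ i₁<i₂)
    1≤i₃ : 1 ≤ i₃
    1≤i₃ = ≤-trans 1≤i₂ (<⇒≤ i₂<i₃)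
    i₂≤L : i₂ ≤ L
    i₂≤L = ≤-trans (<⇒≤ i₂<i₃) i₃≤L
    i₁≤L : i₁ ≤ L
    i₁≤L = ≤-trans (<⇒≤ i₁<i₂) i₂≤L

    a₁<a₃ : a₁ < a₃
    a₁<a₃ = Equivalence.from (orderIso 1 3 ≤-refl (s≤s z≤n) (s≤s z≤n) ≤-refl) (s≤s (s≤s z≤n))
    a₃<a₂ : a₃ < a₂
    a₃<a₂ = Equivalence.from (orderIso 3 2 (s≤s z≤n) ≤-refl (s≤s z≤n) (s≤s (s≤s z≤n))) (s≤s (s≤s (s≤s z≤n)))

    V₀ : V 0 ≡ 0
    V₀ = V-first
    V₁ : V 1 ≡ a₁
    V₁ = V-vals 1 ≤-refl (s≤s z≤n)
    V₂ : V 2 ≡ a₃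
    V₂ = V-vals 3 (s≤s z≤n) ≤-refl
    V₃ : V 3 ≡ a₂
    V₃ = V-vals 2 (s≤s z≤n) (s≤s (s≤s z≤n))
    V₄ : V 4 ≡ suc L
    V₄ = V-last

    shaded : (a b : ℕ) → {True ((a , b) ∈? MeshPattern.R p₀)} → (a , b) ∈ MeshPattern.R p₀
    shaded a b {p} = toWitness p

    empty : ∀ {a b} → (a , b) ∈ MeshPattern.R p₀ → ∀ {x lo hi} → V b ≡ lo → V (suc b) ≡ hi →
            ι a < x → x < ι (suc a) → lo < at σ x → at σ x < hi → ⊥
    empty m refl refl = shading _ _ m _

    range : ∀ {x} → 1 ≤ x → x ≤ L → 1 ≤ at σ x × at σ x ≤ L
    range = at-perm-range σ↭

    distinct : ∀ {x y} → 1 ≤ x → x ≤ L → 1 ≤ y → y ≤ L → x ≢ y → at σ x ≢ at σ y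
    distinct = at-perm-injective σ↭

    -- A value other than a₁, a₃, a₂ lies in one of the four open rows.
    column-empty : ∀ {a} → (∀ b → b ≤ 3 → (a , b) ∈ MeshPattern.R p₀) →
                   ∀ {x} → ι a < x → x < ι (suc a) → 1 ≤ x → x ≤ L →
                   at σ x ≢ a₁ → at σ x ≢ a₃ → at σ x ≢ a₂ → ⊥
    column-empty {a} all-shaded {x} ι<x x<ι 1≤x x≤L ≢a₁ ≢a₃ ≢a₂ with <-cmp (at σ x) a₁
    ... | tri< v<a₁ _ _  = empty (all-shaded 0 z≤n) V₀ V₁ ι<x x<ι (proj₁ (range 1≤x x≤L)) v<a₁
    ... | tri≈ _ v≡a₁ _  = ≢a₁ v≡a₁
    ... | tri> _ _ a₁<v with <-cmp (at σ x) a₃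
    ...   | tri< v<a₃ _ _  = empty (all-shaded 1 (s≤s z≤n)) V₁ V₂ ι<x x<ι a₁<v v<a₃
    ...   | tri≈ _ v≡a₃ _  = ≢a₃ v≡a₃
    ...   | tri> _ _ a₃<v with <-cmp (at σ x) a₂
    ...     | tri< v<a₂ _ _  = empty (all-shaded 2 (s≤s (s≤s z≤n))) V₂ V₃ ι<x x<ι a₃<v v<a₂
    ...     | tri≈ _ v≡a₂ _  = ≢a₂ v≡a₂
    ...     | tri> _ _ a₂<v  = empty (all-shaded 3 (s≤s (s≤s (s≤s z≤n)))) V₃ V₄ ι<x x<ι a₂<v (s≤s (proj₂ (range 1≤x x≤L)))

    column-2-shaded : ∀ b → b ≤ 3 → (2 , b) ∈ MeshPattern.R p₀
    column-2-shaded 0 _ = shaded 2 0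
    column-2-shaded 1 _ = shaded 2 1
    column-2-shaded 2 _ = shaded 2 2
    column-2-shaded 3 _ = shaded 2 3
    column-2-shaded (suc (suc (suc (suc _)))) (s≤s (s≤s (s≤s ())))

    i₃≡1+i₂ : i₃ ≡ suc i₂
    i₃≡1+i₂ with <-cmp (suc i₂) i₃
    ... | tri≈ _ eq _ = sym eq
    ... | tri> _ _ i₃<1+i₂ = ⊥-elim (<⇒≱ i₂<i₃ (≤-pred i₃<1+i₂))
    ... | tri< 1+i₂<i₃ _ _ = ⊥-elim (column-empty column-2-shaded ≤-refl 1+i₂<i₃ (s≤s z≤n) 1+i₂≤L
      (distinct (s≤s z≤n) 1+i₂≤L 1≤i₁ i₁≤L (λ eq → <⇒≢ (<-trans i₁<i₂ (n<1+n i₂)) (sym eq)))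
      (distinct (s≤s z≤n) 1+i₂≤L 1≤i₃ i₃≤L (<⇒≢ 1+i₂<i₃))
      (distinct (s≤s z≤n) 1+i₂≤L 1≤i₂ i₂≤L (λ eq → <⇒≢ (n<1+n i₂) (sym eq))))
      where 1+i₂≤L = ≤-trans (<⇒≤ 1+i₂<i₃) i₃≤L

    -- Left of i₂ the rows above a₃ are shaded.
    shaded-above-a₃ : ∀ {c x} → (c , 2) ∈ MeshPattern.R p₀ → (c , 3) ∈ MeshPattern.R p₀ →
                      ι c < x → x < ι (suc c) → 1 ≤ x → x < i₂ → at σ x < a₃
    shaded-above-a₃ {x = x} row₂ row₃ ι<x x<ι 1≤x x<i₂ with <-cmp (at σ x) a₃
    ... | tri< v<a₃ _ _ = v<a₃
    ... | tri≈ _ v≡a₃ _ = ⊥-elim (distinct 1≤x x≤L 1≤i₃ i₃≤L (<⇒≢ (<-trans x<i₂ i₂<i₃)) v≡a₃)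
      where x≤L = ≤-trans (<⇒≤ x<i₂) i₂≤L
    ... | tri> _ _ a₃<v with <-cmp (at σ x) a₂
    ...   | tri< v<a₂ _ _ = ⊥-elim (empty row₂ V₂ V₃ ι<x x<ι a₃<v v<a₂)
    ...   | tri≈ _ v≡a₂ _ = ⊥-elim (distinct 1≤x (≤-trans (<⇒≤ x<i₂) i₂≤L) 1≤i₂ i₂≤L (<⇒≢ x<i₂) v≡a₂)
    ...   | tri> _ _ a₂<v = ⊥-elim (empty row₃ V₃ V₄ ι<x x<ι a₂<v (s≤s (proj₂ (range 1≤x (≤-trans (<⇒≤ x<i₂) i₂≤L)))))

    before-i₂ : ∀ {x} → 1 ≤ x → x < i₂ → at σ x < a₃
    before-i₂ {x} 1≤x x<i₂ with <-cmp x i₁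
    ... | tri≈ _ refl _ = a₁<a₃
    ... | tri< x<i₁ _ _ = shaded-above-a₃ (shaded 0 2) (shaded 0 3) (subst (_< x) (sym ι-first) 1≤x) x<i₁ 1≤x x<i₂
    ... | tri> _ _ i₁<x = shaded-above-a₃ (shaded 1 2) (shaded 1 3) i₁<x x<i₂ 1≤x x<i₂


    data Position (y : ℕ) : Set where
      before : y < i₂ → Position y
      at-i₂  : y ≡ i₂ → Position y
      at-i₃  : y ≡ i₃ → Position y
      after  : i₃ < y → Position y

    locate : ∀ y → Position y
    locate y with <-cmp y i₂
    ... | tri< y<i₂ _ _ = before y<i₂
    ... | tri≈ _ y≡i₂ _ = at-i₂ y≡i₂
    ... | tri> _ _ i₂<y with <-cmp y i₃
    ...   | tri< y<i₃ _ _ = ⊥-elim (<⇒≱ y<i₃ (subst (_≤ y) (sym i₃≡1+i₂) i₂<y))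
    ...   | tri≈ _ y≡i₃ _ = at-i₃ y≡i₃
    ...   | tri> _ _ i₃<y = after i₃<y

    -- A value strictly between a₃ and a₂ would have to sit in a shaded box.
    a₂≡1+a₃ : a₂ ≡ suc a₃
    a₂≡1+a₃ with <-cmp (suc a₃) a₂
    ... | tri≈ _ eq _ = sym eq
    ... | tri> _ _ a₂<1+a₃ = ⊥-elim (<⇒≱ a₃<a₂ (≤-pred a₂<1+a₃))
    ... | tri< 1+a₃<a₂ _ _
      with y , 1≤y , y≤L , at≡ ← at-perm-surjective σ↭ (s≤s z≤n)
                                                   (≤-trans (<⇒≤ 1+a₃<a₂) (proj₂ (range 1≤i₂ i₂≤L)))
      with locate y
    ...   | before y<i₂  = ⊥-elim (<-asym (before-i₂ 1≤y y<i₂) (subst (a₃ <_) (sym at≡) (n<1+n a₃)))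
    ...   | at-i₂ refl   = ⊥-elim (<⇒≢ 1+a₃<a₂ (sym at≡))
    ...   | at-i₃ refl   = ⊥-elim (<⇒≢ (n<1+n a₃) at≡)
    ...   | after i₃<y   = ⊥-elim (empty (shaded 3 2) V₂ V₃ i₃<y (subst (y <_) (sym ι-last) (s≤s y≤L))
                                        (subst (a₃ <_) (sym at≡) (n<1+n a₃)) (subst (_< a₂) (sym at≡) 1+a₃<a₂))

    P : ℕ
    P = pred a₃

    a₃≡1+P : a₃ ≡ suc P
    a₃≡1+P = sym (suc-pred a₃ {{>-nonZero (≤-<-trans z≤n a₁<a₃)}})

    P<a₃ : P < a₃
    P<a₃ = subst (P <_) (sym a₃≡1+P) ≤-refl

    a₁<P : a₁ ≢ P → a₁ < P
    a₁<P = ≤∧≢⇒< (≤-pred (subst (a₁ <_) a₃≡1+P a₁<a₃))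

    P-attained : Σ ℕ λ y → 1 ≤ y × y < i₂ × at σ y ≡ P
    P-attained with a₁ ≟ P
    ... | yes a₁≡P = i₁ , 1≤i₁ , i₁<i₂ , a₁≡P
    ... | no  a₁≢P
      with y , 1≤y , y≤L , at≡P ← at-perm-surjective σ↭ (≤-trans (s≤s z≤n) (a₁<P a₁≢P))
                                                     (≤-trans (<⇒≤ P<a₃) (proj₂ (range 1≤i₃ i₃≤L)))
      with locate y
    ...   | before y<i₂ = y , 1≤y , y<i₂ , at≡P
    ...   | at-i₂ refl  = ⊥-elim (<⇒≢ (<-trans P<a₃ a₃<a₂) (sym at≡P))
    ...   | at-i₃ refl  = ⊥-elim (<⇒≢ P<a₃ (sym at≡P))
    ...   | after i₃<y  = ⊥-elim (empty (shaded 3 1) V₁ V₂ i₃<y (subst (y <_) (sym ι-last) (s≤s y≤L))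
                                       (subst (a₁ <_) (sym at≡P) (a₁<P a₁≢P)) (subst (_< a₃) (sym at≡P) P<a₃))

    hit : Hit σ
    hit = record
      { t = i₂ ; P = P
      ; 1+t≤length = subst (_≤ L) i₃≡1+i₂ i₃≤L
      ; at-t = trans a₂≡1+a₃ (cong suc a₃≡1+P)
      ; at-1+t = trans (cong (at σ) (sym i₃≡1+i₂)) a₃≡1+P
      ; prefix≤P = λ x 1≤x x<i₂ → ≤-pred (subst (at σ x <_) a₃≡1+P (before-i₂ 1≤x x<i₂))
      ; P-attained = P-attained }

  Contains⇒Hit : ∀ {σ N} → σ ↭ oneTo N → Contains p₀ σ → Hit σ
  Contains⇒Hit σ↭ (ι , V , O) = OccurrenceToHit.hit σ↭ O

  avoids⇔hits≡0 : ∀ {σ N} → σ ↭ oneTo N → Avoids p₀ σ ⇔ (hits σ ≡ 0)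
  avoids⇔hits≡0 {σ} σ↭ = mk⇔
    (λ avoids → decidable-stable (hits σ ≟ 0) (avoids ∘ Hit⇒Contains ∘ hits≢0⇒Hit σ))
    (λ hits≡0 contains → Hit⇒hits≢0 σ (Contains⇒Hit σ↭ contains) hits≡0)

module Coefficients (u : FPS) (u-inverse : ∀ m → (onePlusX² ⊛ u) m ≡ oneS m) where

  open import Data.Nat as ℕ using (ℕ; zero; suc; _∸_; _!; _<_; _≤_; z≤n; s≤s)
  import Data.Nat.Properties as ℕ
  open import Data.Integer using (ℤ; +_; _+_; _*_; -_; _-_)
  open import Data.Integer.Properties
  open import Data.Integer.Tactic.RingSolver using (solve-∀)
  open import Relation.Binary.PropositionalEquality
  open import Data.List using (List; []; _∷_)
  open import Data.List.Membership.Propositional using (_∈_)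
  open import Data.List.Relation.Unary.Any using (here; there)
  open import Function using (_∘_)
  open import Algebra.Properties.CommutativeSemigroup +-commutativeSemigroup
    using () renaming (interchange to +-interchange)
  open Hits
    using (∑; permutations; hits; hits-permutations-≤; δ; binom; binomPrev; binom-suc; binom->; k+2[1+i];
           hitSets; hitSets-vanish; hitSets-recurrence-0; hitSets-recurrence-suc)

  sumTo-cong : ∀ n {f g : ℕ → ℤ} → (∀ i → f i ≡ g i) → sumTo n f ≡ sumTo n g
  sumTo-cong zero    f≗g = f≗g 0
  sumTo-cong (suc n) f≗g = cong₂ _+_ (sumTo-cong n f≗g) (f≗g (suc n))

  sumTo-suc : ∀ n (f : ℕ → ℤ) → sumTo (suc n) f ≡ f 0 + sumTo n (f ∘ suc)
  sumTo-suc zero    f = refl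
  sumTo-suc (suc n) f = trans (cong (_+ f (suc (suc n))) (sumTo-suc n f)) (+-assoc (f 0) _ _)

  sumTo-distrib-+ : ∀ n (f g : ℕ → ℤ) → sumTo n (λ i → f i + g i) ≡ sumTo n f + sumTo n g
  sumTo-distrib-+ zero    f g = refl
  sumTo-distrib-+ (suc n) f g =
    trans (cong (_+ (f (suc n) + g (suc n))) (sumTo-distrib-+ n f g)) (+-interchange (sumTo n f) _ _ _)

  sumTo-neg : ∀ n (f : ℕ → ℤ) → sumTo n (λ i → - f i) ≡ - sumTo n f
  sumTo-neg zero    f = refl
  sumTo-neg (suc n) f = trans (cong (_+ - f (suc n)) (sumTo-neg n f)) (sym (neg-distrib-+ (sumTo n f) _))

  sumTo-zero : ∀ n {f : ℕ → ℤ} → (∀ i → f i ≡ + 0) → sumTo n f ≡ + 0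
  sumTo-zero zero    f≗0 = f≗0 0
  sumTo-zero (suc n) f≗0 = cong₂ _+_ (sumTo-zero n f≗0) (f≗0 (suc n))

  sumTo-reverse : ∀ n (f : ℕ → ℤ) → sumTo n f ≡ sumTo n (λ i → f (n ∸ i))
  sumTo-reverse zero    f = refl
  sumTo-reverse (suc n) f =
    trans (cong (_+ f (suc n)) (sumTo-reverse n f)) (trans (+-comm _ (f (suc n))) (sym (sumTo-suc n (λ i → f (suc n ∸ i)))))

  sumTo-xS : ∀ m (w : ℕ → ℤ) → sumTo m (λ i → xS (suc i) * w i) ≡ w 0
  sumTo-xS zero    w = *-identityˡ (w 0)
  sumTo-xS (suc m) w = trans (sumTo-suc m _)
    (trans (cong₂ _+_ (*-identityˡ (w 0)) (sumTo-zero m (λ i → *-zeroˡ (w (suc i))))) (+-identityʳ (w 0)))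

  sumTo-onePlusX² : ∀ m (w : ℕ → ℤ) → sumTo m (λ i → onePlusX² (suc (suc i)) * w i) ≡ w 0
  sumTo-onePlusX² zero    w = *-identityˡ (w 0)
  sumTo-onePlusX² (suc m) w = trans (sumTo-suc m _)
    (trans (cong₂ _+_ (*-identityˡ (w 0)) (sumTo-zero m (λ i → *-zeroˡ (w (suc (suc i)))))) (+-identityʳ (w 0)))

  u-0 : u 0 ≡ + 1
  u-0 = trans (sym (*-identityˡ (u 0))) (u-inverse 0)

  u-1 : u 1 ≡ + 0
  u-1 = trans (sym (trans (cong₂ _+_ (*-identityˡ (u 1)) (*-zeroˡ (u 0))) (+-identityʳ (u 1)))) (u-inverse 1)

  u-suc-suc : ∀ m → u (suc (suc m)) ≡ - u m
  u-suc-suc m = begin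
    u (suc (suc m))                       ≡⟨ +-identityʳ _ ⟨
    u (suc (suc m)) + + 0                 ≡⟨ cong (λ t → u (suc (suc m)) + t) (+-inverseʳ (u m)) ⟨
    u (suc (suc m)) + (u m + - u m)       ≡⟨ +-assoc (u (suc (suc m))) (u m) (- u m) ⟨
    u (suc (suc m)) + u m + - u m         ≡⟨ cong (_+ - u m) u+u≡0 ⟩
    + 0 + - u m                           ≡⟨ +-identityˡ (- u m) ⟩
    - u m                                 ∎
    where
    open ≡-Reasoning
    F : ℕ → ℤ
    F i = onePlusX² i * u (suc (suc m) ∸ i)
    u+u≡0 : u (suc (suc m)) + u m ≡ + 0
    u+u≡0 = begin
      u (suc (suc m)) + u m
        ≡⟨ cong₂ _+_ (*-identityˡ (u (suc (suc m))))
                     (trans (cong₂ _+_ (*-zeroˡ (u (suc m))) (sumTo-onePlusX² m (λ i → u (m ∸ i)))) (+-identityˡ (u m))) ⟨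
      F 0 + (F 1 + sumTo m (λ i → F (suc (suc i))))  ≡⟨ cong (λ t → F 0 + t) (sumTo-suc m (F ∘ suc)) ⟨
      F 0 + sumTo (suc m) (F ∘ suc)                   ≡⟨ sumTo-suc (suc m) F ⟨
      sumTo (suc (suc m)) F                           ≡⟨ u-inverse (suc (suc m)) ⟩
      + 0                                             ∎

  g : FPS
  g = xS ⊛ u

  g-0 : g 0 ≡ + 0
  g-0 = *-zeroˡ (u 0)

  g-suc : ∀ n → g (suc n) ≡ u n
  g-suc n = trans (sumTo-suc n _)
    (trans (cong₂ _+_ (*-zeroˡ (u (suc n))) (sumTo-xS n (λ i → u (n ∸ i)))) (+-identityˡ (u n)))

  g-1 : g 1 ≡ + 1
  g-1 = trans (g-suc 0) u-0

  g-suc-suc : ∀ i → g (suc (suc i)) ≡ - g i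
  g-suc-suc zero    = trans (g-suc 1) (trans u-1 (sym (cong -_ g-0)))
  g-suc-suc (suc i) = trans (g-suc (suc (suc i))) (trans (u-suc-suc i) (cong -_ (sym (g-suc i))))

  -- (1 + x²) g = x, read off coefficientwise after multiplying by h.
  g⊛-suc-suc : ∀ (h : FPS) n → (g ⊛ h) (suc (suc n)) ≡ h (suc n) - (g ⊛ h) n
  g⊛-suc-suc h n = begin
    (g ⊛ h) (suc (suc n))
      ≡⟨ sumTo-suc (suc n) _ ⟩
    g 0 * h (suc (suc n)) + sumTo (suc n) (λ i → g (suc i) * h (suc n ∸ i))
      ≡⟨ cong₂ _+_ (trans (cong (_* h (suc (suc n))) g-0) (*-zeroˡ (h (suc (suc n))))) (sumTo-suc n _) ⟩
    + 0 + (g 1 * h (suc n) + sumTo n (λ i → g (suc (suc i)) * h (n ∸ i)))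
      ≡⟨ +-identityˡ _ ⟩
    g 1 * h (suc n) + sumTo n (λ i → g (suc (suc i)) * h (n ∸ i))
      ≡⟨ cong₂ _+_ (trans (cong (_* h (suc n)) g-1) (*-identityˡ _))
                   (trans (sumTo-cong n (λ i → trans (cong (_* h (n ∸ i)) (g-suc-suc i)) (sym (neg-distribˡ-* (g i) (h (n ∸ i))))))
                          (sumTo-neg n _)) ⟩
    h (suc n) - (g ⊛ h) n
      ∎
    where open ≡-Reasoning

  gPow : ℕ → ℕ → ℤ
  gPow k n = (g ^S k) n

  gPow-suc-0 : ∀ k → gPow (suc k) 0 ≡ + 0
  gPow-suc-0 k = trans (cong (_* gPow k 0) g-0) (*-zeroˡ (gPow k 0))

  gPow-suc-1 : ∀ k → gPow (suc k) 1 ≡ gPow k 0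
  gPow-suc-1 k = trans (cong₂ _+_ (trans (cong (_* gPow k 1) g-0) (*-zeroˡ (gPow k 1)))
                                  (trans (cong (_* gPow k 0) g-1) (*-identityˡ _)))
                       (+-identityˡ _)

  gPow-suc-suc : ∀ k n → gPow (suc k) (suc (suc n)) ≡ gPow k (suc n) - gPow (suc k) n
  gPow-suc-suc k = g⊛-suc-suc (g ^S k)

  gPow-below : ∀ {k n} → n < k → gPow k n ≡ + 0
  gPow-below {suc k} {zero}        _         = gPow-suc-0 k
  gPow-below {suc k} {suc zero}    (s≤s 1≤k) = trans (gPow-suc-1 k) (gPow-below 1≤k)
  gPow-below {suc k} {suc (suc n)} (s≤s n<k) =
    trans (gPow-suc-suc k n) (cong₂ _-_ (gPow-below n<k) (gPow-below (ℕ.<-trans (ℕ.n<1+n n) (ℕ.m<n⇒m<1+n n<k))))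

  gPow-diagonal : ∀ k → gPow (suc k) (suc k) ≡ gPow k k
  gPow-diagonal zero    = gPow-suc-1 0
  gPow-diagonal (suc k) = trans (gPow-suc-suc (suc k) k)
    (trans (cong (λ t → gPow (suc k) (suc k) - t) (gPow-below (ℕ.<-trans (ℕ.n<1+n k) (ℕ.n<1+n (suc k))))) (+-identityʳ _))

  -- g is odd, so g^k has only coefficients of the parity of k.
  gPow-odd : ∀ k j → gPow k (suc (k ℕ.+ (j ℕ.+ j))) ≡ + 0
  gPow-odd zero    j       = refl
  gPow-odd (suc k) zero    = begin
    gPow (suc k) (suc (suc (k ℕ.+ 0)))         ≡⟨ gPow-suc-suc k (k ℕ.+ 0) ⟩
    gPow k (suc (k ℕ.+ 0)) - gPow (suc k) (k ℕ.+ 0)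
      ≡⟨ cong₂ _-_ (gPow-odd k 0) (gPow-below (ℕ.≤-trans (s≤s (ℕ.≤-reflexive (ℕ.+-identityʳ k))) ℕ.≤-refl)) ⟩
    + 0                                        ∎
    where open ≡-Reasoning
  gPow-odd (suc k) (suc i) = begin
    gPow (suc k) (suc (suc (k ℕ.+ (suc i ℕ.+ suc i))))
      ≡⟨ gPow-suc-suc k (k ℕ.+ (suc i ℕ.+ suc i)) ⟩
    gPow k (suc (k ℕ.+ (suc i ℕ.+ suc i))) - gPow (suc k) (k ℕ.+ (suc i ℕ.+ suc i))
      ≡⟨ cong₂ _-_ (gPow-odd k (suc i)) (trans (cong (gPow (suc k)) (k+2[1+i] k i)) (gPow-odd (suc k) i)) ⟩
    + 0
      ∎
    where open ≡-Reasoning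

  -1^_ : ℕ → ℤ
  -1^ zero  = + 1
  -1^ suc j = - (-1^ j)

  scaledCoeff : ℕ → ℕ → ℤ
  scaledCoeff k j = + (k !) * gPow k (k ℕ.+ (j ℕ.+ j))

  scaledCoeff-suc-0 : ∀ k → scaledCoeff (suc k) 0 ≡ + suc k * scaledCoeff k 0
  scaledCoeff-suc-0 k = begin
    + (suc k ℕ.* k !) * gPow (suc k) (suc k ℕ.+ 0)
      ≡⟨ cong₂ _*_ (pos-* (suc k) (k !))
                   (trans (cong (gPow (suc k)) (ℕ.+-identityʳ (suc k))) (trans (gPow-diagonal k) (cong (gPow k) (sym (ℕ.+-identityʳ k))))) ⟩
    (+ suc k * + (k !)) * gPow k (k ℕ.+ 0)
      ≡⟨ *-assoc (+ suc k) (+ (k !)) _ ⟩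
    + suc k * scaledCoeff k 0
      ∎
    where open ≡-Reasoning

  scaledCoeff-suc-suc : ∀ k i → scaledCoeff (suc k) (suc i) ≡ + suc k * scaledCoeff k (suc i) - scaledCoeff (suc k) i
  scaledCoeff-suc-suc k i = begin
    + (suc k ℕ.* k !) * gPow (suc k) (suc k ℕ.+ (suc i ℕ.+ suc i))
      ≡⟨ cong₂ _*_ (pos-* (suc k) (k !)) (trans (cong (λ t → gPow (suc k) (suc t)) (k+2[1+i] k i)) (gPow-suc-suc k n)) ⟩
    (+ suc k * + (k !)) * (gPow k (suc n) - gPow (suc k) n)
      ≡⟨ cong (λ t → (+ suc k * + (k !)) * (gPow k t - gPow (suc k) n)) (k+2[1+i] k i) ⟨
    (+ suc k * + (k !)) * (gPow k (k ℕ.+ (suc i ℕ.+ suc i)) - gPow (suc k) n)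
      ≡⟨ distribute (+ suc k) (+ (k !)) _ _ ⟩
    + suc k * scaledCoeff k (suc i) - (+ suc k * + (k !)) * gPow (suc k) n
      ≡⟨ cong (λ t → + suc k * scaledCoeff k (suc i) - t * gPow (suc k) n) (pos-* (suc k) (k !)) ⟨
    + suc k * scaledCoeff k (suc i) - scaledCoeff (suc k) i
      ∎
    where
    open ≡-Reasoning
    n = suc k ℕ.+ (i ℕ.+ i)
    distribute : ∀ a b x y → (a * b) * (x - y) ≡ a * (b * x) - (a * b) * y
    distribute = solve-∀

  -- Both sides obey the same recurrence in (k, j) with the same initial values.
  scaledCoeff≡hitSets : ∀ k j → scaledCoeff k j ≡ -1^ j * + hitSets (k ℕ.+ (j ℕ.+ j)) j
  scaledCoeff≡hitSets zero    zero    = refl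
  scaledCoeff≡hitSets zero    (suc i) =
    sym (trans (cong (λ t → -1^ suc i * + t) (hitSets-vanish (suc i ℕ.+ suc i) i ℕ.≤-refl)) (*-zeroʳ (-1^ suc i)))
  scaledCoeff≡hitSets (suc k) zero    = begin
    scaledCoeff (suc k) 0                        ≡⟨ scaledCoeff-suc-0 k ⟩
    + suc k * scaledCoeff k 0                    ≡⟨ cong (+ suc k *_) (scaledCoeff≡hitSets k 0) ⟩
    + suc k * (+ 1 * + hitSets (k ℕ.+ 0) 0)       ≡⟨ cong (+ suc k *_) (*-identityˡ _) ⟩
    + suc k * + hitSets (k ℕ.+ 0) 0              ≡⟨ pos-* (suc k) _ ⟨
    + (suc k ℕ.* hitSets (k ℕ.+ 0) 0)            ≡⟨ cong +_ (hitSets-recurrence-0 k) ⟨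
    + hitSets (suc k ℕ.+ 0) 0                    ≡⟨ *-identityˡ _ ⟨
    + 1 * + hitSets (suc k ℕ.+ 0) 0              ∎
    where open ≡-Reasoning
  scaledCoeff≡hitSets (suc k) (suc i) = begin
    scaledCoeff (suc k) (suc i)                            ≡⟨ scaledCoeff-suc-suc k i ⟩
    + suc k * scaledCoeff k (suc i) - scaledCoeff (suc k) i
      ≡⟨ cong₂ (λ a b → + suc k * a - b) (scaledCoeff≡hitSets k (suc i)) (scaledCoeff≡hitSets (suc k) i) ⟩
    + suc k * (- (-1^ i) * + A) - -1^ i * + B               ≡⟨ regroup (+ suc k) (-1^ i) (+ A) (+ B) ⟩
    - (-1^ i) * (+ suc k * + A + + B)                       ≡⟨ cong (λ t → - (-1^ i) * (t + + B)) (pos-* (suc k) A) ⟨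
    - (-1^ i) * (+ (suc k ℕ.* A) + + B)                     ≡⟨ cong (λ t → - (-1^ i) * t) (pos-+ (suc k ℕ.* A) B) ⟨
    - (-1^ i) * + (suc k ℕ.* A ℕ.+ B)                       ≡⟨ cong (λ t → - (-1^ i) * + t) (hitSets-recurrence-suc k i) ⟨
    -1^ suc i * + hitSets (suc k ℕ.+ (suc i ℕ.+ suc i)) (suc i) ∎
    where
    open ≡-Reasoning
    A = hitSets (k ℕ.+ (suc i ℕ.+ suc i)) (suc i)
    B = hitSets (suc k ℕ.+ (i ℕ.+ i)) i
    regroup : ∀ a s x y → a * (- s * x) - s * y ≡ - s * (a * x + y)
    regroup = solve-∀

  sumTo-evens : ∀ n (φ ψ : ℕ → ℤ) →
    (∀ j → suc (j ℕ.+ j) ≤ n → φ (suc (j ℕ.+ j)) ≡ + 0) →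
    (∀ j → j ℕ.+ j ≤ n → φ (j ℕ.+ j) ≡ ψ j) →
    (∀ j → n < j ℕ.+ j → ψ j ≡ + 0) →
    sumTo n φ ≡ sumTo n ψ
  sumTo-evens zero          φ ψ odd even beyond = even 0 z≤n
  sumTo-evens (suc zero)    φ ψ odd even beyond = cong₂ _+_ (even 0 z≤n) (trans (odd 0 ℕ.≤-refl) (sym (beyond 1 ℕ.≤-refl)))
  sumTo-evens (suc (suc n)) φ ψ odd even beyond = begin
    sumTo (suc (suc n)) φ                                   ≡⟨ sumTo-suc (suc n) φ ⟩
    φ 0 + sumTo (suc n) (φ ∘ suc)                           ≡⟨ cong (λ t → φ 0 + t) (sumTo-suc n (φ ∘ suc)) ⟩
    φ 0 + (φ 1 + sumTo n (φ ∘ suc ∘ suc))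
      ≡⟨ cong₂ (λ a b → a + (b + sumTo n (φ ∘ suc ∘ suc))) (even 0 z≤n) (odd 0 (s≤s z≤n)) ⟩
    ψ 0 + (+ 0 + sumTo n (φ ∘ suc ∘ suc))                   ≡⟨ cong (λ t → ψ 0 + t) (+-identityˡ _) ⟩
    ψ 0 + sumTo n (φ ∘ suc ∘ suc)
      ≡⟨ cong (λ t → ψ 0 + t) (sumTo-evens n (φ ∘ suc ∘ suc) (ψ ∘ suc) odd′ even′ beyond′) ⟩
    ψ 0 + sumTo n (ψ ∘ suc)                                 ≡⟨ cong (λ t → ψ 0 + t) (+-identityʳ _) ⟨
    ψ 0 + (sumTo n (ψ ∘ suc) + + 0)
      ≡⟨ cong (λ t → ψ 0 + (sumTo n (ψ ∘ suc) + t)) (beyond (suc (suc n)) (ℕ.m<m+n (suc (suc n)) (s≤s z≤n))) ⟨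
    ψ 0 + sumTo (suc n) (ψ ∘ suc)                           ≡⟨ sumTo-suc (suc n) ψ ⟨
    sumTo (suc (suc n)) ψ                                   ∎
    where
    open ≡-Reasoning
    2[1+j] : ∀ j → suc j ℕ.+ suc j ≡ suc (suc (j ℕ.+ j))
    2[1+j] j = cong suc (ℕ.+-suc j j)
    odd′ : ∀ j → suc (j ℕ.+ j) ≤ n → φ (suc (suc (suc (j ℕ.+ j)))) ≡ + 0
    odd′ j le = subst (λ t → φ (suc t) ≡ + 0) (2[1+j] j)
                      (odd (suc j) (subst (λ t → suc t ≤ suc (suc n)) (sym (2[1+j] j)) (s≤s (s≤s le))))
    even′ : ∀ j → j ℕ.+ j ≤ n → φ (suc (suc (j ℕ.+ j))) ≡ ψ (suc j)
    even′ j le = subst (λ t → φ t ≡ ψ (suc j)) (2[1+j] j)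
                       (even (suc j) (subst (_≤ suc (suc n)) (sym (2[1+j] j)) (s≤s (s≤s le))))
    beyond′ : ∀ j → n < j ℕ.+ j → ψ (suc j) ≡ + 0
    beyond′ j lt = beyond (suc j) (subst (suc (suc n) <_) (sym (2[1+j] j)) (s≤s (s≤s lt)))

  alternating-binom : ∀ o B → o ≤ B → sumTo B (λ j → -1^ j * + binom o j) ≡ + δ o 0
  alternating-binom zero    zero    _ = refl
  alternating-binom zero    (suc B) _ = trans (cong₂ _+_ (alternating-binom zero B z≤n) (*-zeroʳ (-1^ suc B))) refl
  alternating-binom (suc p) (suc B) (s≤s p≤B) = begin
    sumTo (suc B) (λ j → -1^ j * + binom (suc p) j)
      ≡⟨ sumTo-cong (suc B) (λ j → trans (cong (λ t → -1^ j * + t) (binom-suc p j))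
                                   (trans (cong (-1^ j *_) (pos-+ (binom p j) (binomPrev p j))) (*-distribˡ-+ (-1^ j) _ _))) ⟩
    sumTo (suc B) (λ j → -1^ j * + binom p j + -1^ j * + binomPrev p j)
      ≡⟨ sumTo-distrib-+ (suc B) (λ j → -1^ j * + binom p j) (λ j → -1^ j * + binomPrev p j) ⟩
    (S + -1^ suc B * + binom p (suc B)) + sumTo (suc B) (λ j → -1^ j * + binomPrev p j)
      ≡⟨ cong₂ _+_ (trans (cong (λ t → S + -1^ suc B * + t) (binom-> (s≤s p≤B)))
                          (trans (cong (λ t → S + t) (*-zeroʳ (-1^ suc B))) (+-identityʳ S)))
                   (sumTo-suc B (λ j → -1^ j * + binomPrev p j)) ⟩
    S + (+ 0 + sumTo B (λ j → - (-1^ j) * + binom p j))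
      ≡⟨ cong (λ t → S + t) (trans (+-identityˡ _) (trans (sumTo-cong B (λ j → sym (neg-distribˡ-* (-1^ j) (+ binom p j))))
                                                          (sumTo-neg B _))) ⟩
    S + - S
      ≡⟨ +-inverseʳ S ⟩
    + 0
      ∎
    where
    open ≡-Reasoning
    S = sumTo B (λ j → -1^ j * + binom p j)

  ∑ℤ : ∀ {A : Set} → List A → (A → ℤ) → ℤ
  ∑ℤ []       f = + 0
  ∑ℤ (x ∷ xs) f = f x + ∑ℤ xs f

  +-∑ : ∀ {A : Set} (xs : List A) f → + ∑ xs f ≡ ∑ℤ xs (λ x → + f x)
  +-∑ []       f = refl
  +-∑ (x ∷ xs) f = trans (pos-+ (f x) _) (cong (λ t → + f x + t) (+-∑ xs f))

  ∑ℤ-cong∈ : ∀ {A : Set} (xs : List A) {f g : A → ℤ} → (∀ {x} → x ∈ xs → f x ≡ g x) → ∑ℤ xs f ≡ ∑ℤ xs g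
  ∑ℤ-cong∈ []       f≗g = refl
  ∑ℤ-cong∈ (x ∷ xs) f≗g = cong₂ _+_ (f≗g (here refl)) (∑ℤ-cong∈ xs (f≗g ∘ there))

  ∑ℤ-sumTo : ∀ {A : Set} (xs : List A) n (F : A → ℕ → ℤ) →
             ∑ℤ xs (λ x → sumTo n (F x)) ≡ sumTo n (λ j → ∑ℤ xs (λ x → F x j))
  ∑ℤ-sumTo []       n F = sym (sumTo-zero n (λ _ → refl))
  ∑ℤ-sumTo (x ∷ xs) n F = trans (cong (λ t → sumTo n (F x) + t) (∑ℤ-sumTo xs n F)) (sym (sumTo-distrib-+ n (F x) _))

  ∑ℤ-*ˡ : ∀ {A : Set} (xs : List A) c (F : A → ℤ) → ∑ℤ xs (λ x → c * F x) ≡ c * ∑ℤ xs F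
  ∑ℤ-*ˡ []       c F = sym (*-zeroʳ c)
  ∑ℤ-*ˡ (x ∷ xs) c F = trans (cong (λ t → c * F x + t) (∑ℤ-*ˡ xs c F)) (sym (*-distribˡ-+ c (F x) _))

  -- Inclusion–exclusion over the sets of hits.
  count-hitless : ∀ n → + ∑ (permutations n) (λ σ → δ (hits σ) 0) ≡ sumTo n (λ j → -1^ j * + hitSets n j)
  count-hitless n = begin
    + ∑ P (λ σ → δ (hits σ) 0)                            ≡⟨ +-∑ P (λ σ → δ (hits σ) 0) ⟩
    ∑ℤ P (λ σ → + δ (hits σ) 0)
      ≡⟨ ∑ℤ-cong∈ P (λ {σ} σ∈ → alternating-binom (hits σ) n (hits-permutations-≤ n σ∈)) ⟨
    ∑ℤ P (λ σ → sumTo n (λ j → -1^ j * + binom (hits σ) j)) ≡⟨ ∑ℤ-sumTo P n (λ σ j → -1^ j * + binom (hits σ) j) ⟩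
    sumTo n (λ j → ∑ℤ P (λ σ → -1^ j * + binom (hits σ) j))
      ≡⟨ sumTo-cong n (λ j → trans (∑ℤ-*ˡ P (-1^ j) (λ σ → + binom (hits σ) j))
                                   (cong (-1^ j *_) (sym (+-∑ P (λ σ → binom (hits σ) j))))) ⟩
    sumTo n (λ j → -1^ j * + hitSets n j)                 ∎
    where
    open ≡-Reasoning
    P = permutations n

  -- The term k = n − 2j of Σ k! [xⁿ] g^k is (−1)^j hitSets n j; the terms with n − k odd vanish.
  alternating-hitSets≡sumFactPowers : ∀ n → sumTo n (λ j → -1^ j * + hitSets n j) ≡ sumFactPowers g n
  alternating-hitSets≡sumFactPowers n = sym (trans (sumTo-reverse n F) (sumTo-evens n (F ∘ (n ∸_)) _ odd even beyond))
    where
    F : ℕ → ℤ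
    F k = + (k !) * gPow k n
    odd : ∀ j → suc (j ℕ.+ j) ≤ n → F (n ∸ suc (j ℕ.+ j)) ≡ + 0
    odd j le = trans (cong (λ t → + (k !) * gPow k t) (sym n≡)) (trans (cong (+ (k !) *_) (gPow-odd k j)) (*-zeroʳ (+ (k !))))
      where
      k = n ∸ suc (j ℕ.+ j)
      n≡ : suc (k ℕ.+ (j ℕ.+ j)) ≡ n
      n≡ = trans (sym (ℕ.+-suc k (j ℕ.+ j))) (ℕ.m∸n+n≡m le)
    even : ∀ j → j ℕ.+ j ≤ n → F (n ∸ (j ℕ.+ j)) ≡ -1^ j * + hitSets n j
    even j le = begin
      + (k !) * gPow k n                     ≡⟨ cong (λ t → + (k !) * gPow k t) n≡ ⟨
      scaledCoeff k j                        ≡⟨ scaledCoeff≡hitSets k j ⟩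
      -1^ j * + hitSets (k ℕ.+ (j ℕ.+ j)) j  ≡⟨ cong (λ t → -1^ j * + hitSets t j) n≡ ⟩
      -1^ j * + hitSets n j                  ∎
      where
      open ≡-Reasoning
      k = n ∸ (j ℕ.+ j)
      n≡ : k ℕ.+ (j ℕ.+ j) ≡ n
      n≡ = ℕ.m∸n+n≡m le
    beyond : ∀ j → n < j ℕ.+ j → -1^ j * + hitSets n j ≡ + 0
    beyond zero    ()
    beyond (suc i) lt = trans (cong (λ t → -1^ suc i * + t) (hitSets-vanish n i (ℕ.<⇒≤ lt))) (*-zeroʳ (-1^ suc i))

open import Data.Nat using (ℕ; _≟_)
open import Data.Integer using (+_)
open import Data.List using (filter; length)
open import Data.List.Membership.Propositional using (_∈_)
open import Data.List.Membership.Propositional.Properties using (∈-filter⁺; ∈-filter⁻)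
import Data.List.Relation.Unary.Unique.Propositional.Properties as Unique
open import Data.Product using (Σ; _×_; _,_)
open import Function.Bundles using (_⇔_; mk⇔; Equivalence)
open Hits
  using (hits; permutations; Unique-permutations; permutations-sound; permutations-complete; length-filter-≟0; avoids⇔hits≡0)
open Coefficients using (count-hitless; alternating-hitSets≡sumFactPowers)

corollary2 : (u : FPS) → (∀ m → (onePlusX² ⊛ u) m ≡ oneS m) →
    ∀ n → Σ ℕ λ c → CardAvoiders p₀ n c × (+ c ≡ sumFactPowers (xS ⊛ u) n)
corollary2 u u-inverse n =
  length avoiders ,
  (avoiders , Unique.filter⁺ (λ σ → hits σ ≟ 0) (Unique-permutations n) , avoiders-spec , refl) ,
  trans (cong +_ (length-filter-≟0 hits (permutations n)))
        (trans (count-hitless u u-inverse n) (alternating-hitSets≡sumFactPowers u u-inverse n))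
  where
  avoiders = filter (λ σ → hits σ ≟ 0) (permutations n)
  avoiders-spec : ∀ σ → (σ ∈ avoiders) ⇔ (IsPerm n σ × Avoids p₀ σ)
  avoiders-spec σ = mk⇔
    (λ σ∈ → let σ∈perms , hits≡0 = ∈-filter⁻ (λ σ → hits σ ≟ 0) σ∈
                σ↭ = permutations-sound n σ∈perms
            in σ↭ , Equivalence.from (avoids⇔hits≡0 σ↭) hits≡0)
    (λ (σ↭ , avoids) →
      ∈-filter⁺ (λ σ → hits σ ≟ 0) (permutations-complete n σ↭) (Equivalence.to (avoids⇔hits≡0 σ↭) avoids))
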